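{- The set $\operatorname{PB}(2)$ of integers $b\ge2$ such that $S_{x^2,b}$ has a propagating $2$-cycle has lower density at least $0.5763$.
   Context: For an integer $b\ge2$, define $S_{x^2,b}(n)=x_0^2+\dots+x_d^2$ where $n=x_0+x_1b+\dots+x_db^d$ is the base-$b$ expansion of $n\ge0$. A $2$-cycle of $S_{x^2,b}$ is a pair of distinct positive integers $n_1,n_2$ with $S_{x^2,b}(n_1)=n_2$ and $S_{x^2,b}(n_2)=n_1$; it is propagating if $n_1,n_2$ have at most two base-$b$ digits and neither is divisible by $b$. The lower density of $S\subseteq\mathbb{N}$ is $\liminf_{n\to\infty}|S\cap\{1,\dots,n\}|/n$. -}

module Defs where

open import Data.Nat using (ℕ; zero; suc; _+_; _*_; _^_; _≤_; _<_; NonZero)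
open import Data.Nat.DivMod using (_/_; _%_)
open import Data.Nat.Divisibility using (_∣_)
open import Data.Product using (Σ; _×_)
open import Data.Empty using (⊥)
open import Data.List using (List; length)
open import Data.List.Relation.Unary.All using (All)
open import Data.List.Relation.Unary.Unique.Propositional using (Unique)
open import Relation.Binary.PropositionalEquality using (_≡_; _≢_)
open import Relation.Nullary using (¬_)

-- Sum of squares of base-b digits, computed with fuel (fuel m suffices for input m, b ≥ 2).
digitSqSumFuel : (b : ℕ) → .{{NonZero b}} → ℕ → ℕ → ℕ
digitSqSumFuel b zero    m = 0
digitSqSumFuel b (suc f) m = (m % b) ^ 2 + digitSqSumFuel b f (m / b)

S : (b : ℕ) → .{{NonZero b}} → ℕ → ℕ
S b n = digitSqSumFuel b n n

-- A propagating 2-cycle of S_{x^2,b}: distinct positive n1, n2 with at most two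
-- base-b digits (i.e. < b^2), neither divisible by b, S(n1) = n2, S(n2) = n1.
HasPropagating2Cycle : (b : ℕ) → .{{NonZero b}} → Set
HasPropagating2Cycle b =
  Σ ℕ λ n₁ → Σ ℕ λ n₂ →
    (1 ≤ n₁) × (1 ≤ n₂) × (n₁ ≢ n₂) ×
    (n₁ < b ^ 2) × (n₂ < b ^ 2) ×
    (¬ (b ∣ n₁)) × (¬ (b ∣ n₂)) ×
    (S b n₁ ≡ n₂) × (S b n₂ ≡ n₁)

PB2 : ℕ → Set
PB2 zero = ⊥
PB2 (suc zero) = ⊥
PB2 (suc (suc c)) = HasPropagating2Cycle (suc (suc c))

-- |P ∩ {1..n}| ≥ m, witnessed by a duplicate-free list of elements of P in [1,n].
AtLeastInRange : (P : ℕ → Set) → ℕ → ℕ → Set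
AtLeastInRange P n m =
  Σ (List ℕ) λ xs → Unique xs × All (λ x → (1 ≤ x) × (x ≤ n) × P x) xs × (m ≤ length xs)

-- liminf_{n→∞} |P ∩ {1..n}| / n ≥ p / q, unfolded: for every k ≥ 1 there is N
-- such that for all n ≥ N, |P ∩ {1..n}| / n ≥ p/q − 1/k,
-- i.e. q·k·|P ∩ {1..n}| + q·n ≥ p·k·n.
LowerDensityAtLeast : (P : ℕ → Set) → (p q : ℕ) → Set
LowerDensityAtLeast P p q =
  (k : ℕ) → 1 ≤ k → Σ ℕ λ N → (n : ℕ) → N ≤ n →
    Σ ℕ λ m → AtLeastInRange P n m × (p * k * n ≤ q * k * m + q * n)

{-# OPTIONS --safe #-}

-- For a modulus p and a residue r, two pairs of digits that are linear in t give, in every base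
-- b = p t + r, a propagating 2-cycle of two-digit numbers; the identities behind such a family are
-- coefficient comparisons in t, checked by evaluation. For a few hundred pairwise coprime moduli
-- (coprimality certified by modular inverses) the Chinese remainder theorem shows that among any
-- Π p consecutive bases at most Π (p − k_p) avoid every covered class, k_p being the number of
-- classes covered modulo p. That product is less than 0.4237 Π p.

module Submission where

open import Defs
import Algebra.Properties.CommutativeSemigroup as CommutativeSemigroupProperties
open import Data.Empty using (⊥-elim)
open import Data.List using (List; []; _∷_; map; length; filter; applyUpTo)
open import Data.List.Membership.Propositional using (_∈_)
open import Data.List.Properties using (length-applyUpTo; map-applyUpTo)
open import Data.List.Relation.Unary.All as All using (All; []; _∷_)
import Data.List.Relation.Unary.All.Properties as Allₚ
open import Data.List.Relation.Unary.AllPairs using ([]; _∷_)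
open import Data.List.Relation.Unary.Any using (here; there)
import Data.List.Relation.Unary.Any.Properties as Anyₚ
open import Data.List.Relation.Unary.Unique.Propositional using (Unique)
import Data.List.Relation.Unary.Unique.Propositional.Properties as Uniqueₚ
open import Data.Nat
open import Data.Nat.DivMod
open import Data.Nat.Divisibility using (_∣_; n∣m*n; n∣m⇒m%n≡0)
open import Data.Nat.ListAction using (sum)
open import Data.Nat.Properties
open import Data.Nat.Tactic.RingSolver using (solve-∀)
open import Data.List.Relation.Unary.Unique.DecPropositional _≟_ using (unique?)
open import Data.Product using (Σ; ∃; _×_; _,_)
open import Data.Sum using (_⊎_; inj₁; inj₂)
open import Data.Unit using (⊤; tt)
open import Function using (_∘_)
open import Relation.Binary.PropositionalEquality
open import Relation.Nullary using (¬_; Dec; yes; no)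
open import Relation.Unary using (Decidable)
open import Relation.Nullary.Decidable using (_×-dec_; _⊎-dec_; map′; from-yes)

private
  module + = CommutativeSemigroupProperties +-commutativeSemigroup
  module * = CommutativeSemigroupProperties *-commutativeSemigroup

module _ {b : ℕ} .{{_ : NonZero b}} where

  lowDigit : ∀ {x} y → x < b → (x + y * b) % b ≡ x
  lowDigit {x} y x<b = trans ([m+kn]%n≡m%n x y b) (m<n⇒m%n≡m x<b)

  highDigit : ∀ {x} y → x < b → (x + y * b) / b ≡ y
  highDigit {x} y x<b = begin
    (x + y * b) / b    ≡⟨ +-distrib-/-∣ʳ x (n∣m*n y) ⟩
    x / b + y * b / b  ≡⟨ cong₂ _+_ (m<n⇒m/n≡0 x<b) (m*n/n≡m y b) ⟩
    y                  ∎
    where open ≡-Reasoning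

  digitSqSumFuel-zero : ∀ f → digitSqSumFuel b f 0 ≡ 0
  digitSqSumFuel-zero zero = refl
  digitSqSumFuel-zero (suc f)
    rewrite m<n⇒m%n≡m (>-nonZero⁻¹ b) | m<n⇒m/n≡0 (>-nonZero⁻¹ b) = digitSqSumFuel-zero f

  digitSqSumFuel-digit : ∀ f {y} → y < b → digitSqSumFuel b (suc f) y ≡ y ^ 2
  digitSqSumFuel-digit f {y} y<b
    rewrite m<n⇒m%n≡m y<b | m<n⇒m/n≡0 y<b | digitSqSumFuel-zero f = +-identityʳ (y ^ 2)

  digitSqSumFuel-twoDigits : ∀ {f x y} → 2 ≤ f → x < b → y < b →
    digitSqSumFuel b f (x + y * b) ≡ x ^ 2 + y ^ 2
  digitSqSumFuel-twoDigits {suc (suc f)} {x} {y} (s≤s (s≤s _)) x<b y<b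
    rewrite lowDigit y x<b | highDigit y x<b = cong (x ^ 2 +_) (digitSqSumFuel-digit f y<b)

  S-digit : ∀ {y} → y < b → S b y ≡ y ^ 2
  S-digit {zero}  _   = refl
  S-digit {suc y} y<b = digitSqSumFuel-digit y y<b

  S-twoDigits : 2 ≤ b → ∀ {x y} → x < b → y < b → S b (x + y * b) ≡ x ^ 2 + y ^ 2
  S-twoDigits _ {x} {zero} x<b _ rewrite +-identityʳ x = trans (S-digit x<b) (sym (+-identityʳ (x ^ 2)))
  S-twoDigits 2≤b {x} {suc y} x<b y<b = digitSqSumFuel-twoDigits 2≤fuel x<b y<b
    where
    2≤fuel : 2 ≤ x + suc y * b
    2≤fuel = ≤-trans 2≤b (≤-trans (m≤n*m b (suc y)) (m≤n+m (suc y * b) x))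

  twoDigit<b² : ∀ {x y} → x < b → y < b → x + y * b < b ^ 2
  twoDigit<b² {x} {y} x<b y<b = begin-strict
    x + y * b  <⟨ +-monoˡ-< (y * b) x<b ⟩
    b + y * b  ≤⟨ *-monoˡ-≤ b y<b ⟩
    b * b      ≡⟨ cong (b *_) (sym (*-identityʳ b)) ⟩
    b ^ 2      ∎
    where open ≤-Reasoning

  twoDigit-∤ : ∀ {x} y → 0 < x → x < b → ¬ (b ∣ x + y * b)
  twoDigit-∤ {x} y 0<x x<b b∣ = <⇒≢ 0<x (sym (trans (sym (lowDigit y x<b)) (n∣m⇒m%n≡0 (x + y * b) b b∣)))

  twoDigit-≢ : ∀ {x x′} y y′ → x < b → x′ < b → x ≢ x′ → x + y * b ≢ x′ + y′ * b
  twoDigit-≢ y y′ x<b x′<b x≢x′ eq =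
    x≢x′ (trans (sym (lowDigit y x<b)) (trans (cong (_% b) eq) (lowDigit y′ x′<b)))

  twoDigitCycle : 2 ≤ b → ∀ {a c d e} → a < b → c < b → d < b → e < b → 0 < a → 0 < d → a ≢ d →
    a ^ 2 + c ^ 2 ≡ d + e * b → d ^ 2 + e ^ 2 ≡ a + c * b → HasPropagating2Cycle b
  twoDigitCycle 2≤b {a} {c} {d} {e} a<b c<b d<b e<b 0<a 0<d a≢d a↦d d↦a =
    a + c * b , d + e * b ,
    ≤-trans 0<a (m≤m+n a (c * b)) , ≤-trans 0<d (m≤m+n d (e * b)) ,
    twoDigit-≢ c e a<b d<b a≢d ,
    twoDigit<b² a<b c<b , twoDigit<b² d<b e<b ,
    twoDigit-∤ c 0<a a<b , twoDigit-∤ e 0<d d<b ,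
    trans (S-twoDigits 2≤b a<b c<b) a↦d , trans (S-twoDigits 2≤b d<b e<b) d↦a

twoDigitCycle⇒PB2 : ∀ {b} → 2 ≤ b → ∀ {a c d e} → a < b → c < b → d < b → e < b → 0 < a → 0 < d → a ≢ d →
  a ^ 2 + c ^ 2 ≡ d + e * b → d ^ 2 + e ^ 2 ≡ a + c * b → PB2 b
twoDigitCycle⇒PB2 {suc (suc _)} 2≤b = twoDigitCycle 2≤b
twoDigitCycle⇒PB2 {suc zero} (s≤s ())

-- Families of 2-cycles with digits linear in the base

^2≡* : ∀ x → x ^ 2 ≡ x * x
^2≡* x = cong (x *_) (*-identityʳ x)

record SquareSumCoefficients (p r A a C c D d E e : ℕ) : Set where
  constructor squareSumCoefficients
  field
    t²-coefficient : A * A + C * C ≡ E * p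
    t¹-coefficient : 2 * A * a + 2 * C * c ≡ D + E * r + e * p
    t⁰-coefficient : a * a + c * c ≡ d + e * r

squareSumCoefficients? : ∀ p r A a C c D d E e → Dec (SquareSumCoefficients p r A a C c D d E e)
squareSumCoefficients? p r A a C c D d E e =
  map′ (λ (t² , t¹ , t⁰) → squareSumCoefficients t² t¹ t⁰)
       (λ (squareSumCoefficients t² t¹ t⁰) → t² , t¹ , t⁰)
       (A * A + C * C ≟ E * p ×-dec 2 * A * a + 2 * C * c ≟ D + E * r + e * p ×-dec a * a + c * c ≟ d + e * r)

squareSum-linear : ∀ {p r A a C c D d E e} → SquareSumCoefficients p r A a C c D d E e → ∀ t →
  (A * t + a) ^ 2 + (C * t + c) ^ 2 ≡ (D * t + d) + (E * t + e) * (p * t + r)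
squareSum-linear {p} {r} {A} {a} {C} {c} {D} {d} {E} {e} (squareSumCoefficients t² t¹ t⁰) t = begin
  (A * t + a) ^ 2 + (C * t + c) ^ 2
    ≡⟨ cong₂ _+_ (^2≡* (A * t + a)) (^2≡* (C * t + c)) ⟩
  (A * t + a) * (A * t + a) + (C * t + c) * (C * t + c)
    ≡⟨ expandLeft A a C c t ⟩
  (A * A + C * C) * (t * t) + (2 * A * a + 2 * C * c) * t + (a * a + c * c)
    ≡⟨ cong₂ _+_ (cong₂ _+_ (cong (_* (t * t)) t²) (cong (_* t) t¹)) t⁰ ⟩
  (E * p) * (t * t) + (D + E * r + e * p) * t + (d + e * r)
    ≡⟨ expandRight D d E e p r t ⟩
  (D * t + d) + (E * t + e) * (p * t + r) ∎
  where
  open ≡-Reasoning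
  expandLeft : ∀ A a C c t → (A * t + a) * (A * t + a) + (C * t + c) * (C * t + c)
    ≡ (A * A + C * C) * (t * t) + (2 * A * a + 2 * C * c) * t + (a * a + c * c)
  expandLeft = solve-∀
  expandRight : ∀ D d E e p r t → (E * p) * (t * t) + (D + E * r + e * p) * t + (d + e * r)
    ≡ (D * t + d) + (E * t + e) * (p * t + r)
  expandRight = solve-∀

IsLinearDigit : (p r A a : ℕ) → Set
IsLinearDigit p r A a = A ≤ p × a < r

isLinearDigit? : ∀ p r A a → Dec (IsLinearDigit p r A a)
isLinearDigit? p r A a = A ≤? p ×-dec a <? r

linearDigit-< : ∀ {p r A a} → IsLinearDigit p r A a → ∀ t → A * t + a < p * t + r
linearDigit-< (A≤p , a<r) t = +-mono-≤-< (*-monoˡ-≤ t A≤p) a<r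

LinearApart : (A a D d : ℕ) → Set
LinearApart A a D d = A ≤ D × a < d ⊎ D ≤ A × d < a

linearApart? : ∀ A a D d → Dec (LinearApart A a D d)
linearApart? A a D d = (A ≤? D ×-dec a <? d) ⊎-dec (D ≤? A ×-dec d <? a)

linearApart-≢ : ∀ {A a D d} → LinearApart A a D d → ∀ t → A * t + a ≢ D * t + d
linearApart-≢ (inj₁ (A≤D , a<d)) t = <⇒≢ (+-mono-≤-< (*-monoˡ-≤ t A≤D) a<d)
linearApart-≢ (inj₂ (D≤A , d<a)) t = ≢-sym (<⇒≢ (+-mono-≤-< (*-monoˡ-≤ t D≤A) d<a))

-- Under IsCycleFamily p, the base is b = p t + residue and the 2-cycle is formed by
-- (A t + a) + (C t + c) b and (D t + d) + (E t + e) b.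
record Family : Set where
  constructor family
  field
    residue : ℕ
    A a C c D d E e : ℕ

IsCycleFamily : ℕ → Family → Set
IsCycleFamily p (family r A a C c D d E e) =
  SquareSumCoefficients p r A a C c D d E e × SquareSumCoefficients p r D d E e A a C c ×
  IsLinearDigit p r A a × IsLinearDigit p r C c × IsLinearDigit p r D d × IsLinearDigit p r E e ×
  0 < a × 0 < d × LinearApart A a D d

isCycleFamily? : ∀ p f → Dec (IsCycleFamily p f)
isCycleFamily? p (family r A a C c D d E e) =
  squareSumCoefficients? p r A a C c D d E e ×-dec squareSumCoefficients? p r D d E e A a C c ×-dec
  isLinearDigit? p r A a ×-dec isLinearDigit? p r C c ×-dec
  isLinearDigit? p r D d ×-dec isLinearDigit? p r E e ×-dec
  0 <? a ×-dec 0 <? d ×-dec linearApart? A a D d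

cycleFamily⇒PB2 : ∀ {p} f → IsCycleFamily p f → ∀ t → PB2 (p * t + Family.residue f)
cycleFamily⇒PB2 {p} (family r A a C c D d E e)
  (a↦d , d↦a , digA@(_ , a<r) , digC , digD , digE , 0<a , 0<d , apart) t =
  twoDigitCycle⇒PB2 2≤b
    (linearDigit-< digA t) (linearDigit-< digC t) (linearDigit-< digD t) (linearDigit-< digE t)
    (≤-trans 0<a (m≤n+m a (A * t))) (≤-trans 0<d (m≤n+m d (D * t)))
    (linearApart-≢ apart t) (squareSum-linear a↦d t) (squareSum-linear d↦a t)
  where
  2≤b : 2 ≤ p * t + r
  2≤b = ≤-trans (s≤s 0<a) (≤-trans a<r (m≤n+m r (p * t)))

residueClass⇒PB2 : ∀ {p} .{{_ : NonZero p}} f → IsCycleFamily p f → ∀ {b} → b % p ≡ Family.residue f → PB2 b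
residueClass⇒PB2 {p} f isCycleFamily {b} b%p≡r = subst PB2 b≡ (cycleFamily⇒PB2 f isCycleFamily (b / p))
  where
  open ≡-Reasoning
  b≡ : p * (b / p) + Family.residue f ≡ b
  b≡ = begin
    p * (b / p) + Family.residue f  ≡⟨ cong (p * (b / p) +_) b%p≡r ⟨
    p * (b / p) + b % p             ≡⟨ +-comm (p * (b / p)) (b % p) ⟩
    b % p + p * (b / p)             ≡⟨ cong (b % p +_) (*-comm p (b / p)) ⟩
    b % p + b / p * p               ≡⟨ m≡m%n+[m/n]*n b p ⟨
    b                               ∎

∑< : ℕ → (ℕ → ℕ) → ℕ
∑< n f = sum (applyUpTo f n)

syntax ∑< n (λ i → f) = ∑[ i < n ] f

∑-cong : ∀ n {f g : ℕ → ℕ} → (∀ i → f i ≡ g i) → ∑< n f ≡ ∑< n g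
∑-cong zero    f≗g = refl
∑-cong (suc n) f≗g = cong₂ _+_ (f≗g 0) (∑-cong n (f≗g ∘ suc))

∑-mono-≤ : ∀ n {f g : ℕ → ℕ} → (∀ i → f i ≤ g i) → ∑< n f ≤ ∑< n g
∑-mono-≤ zero    f≤g = z≤n
∑-mono-≤ (suc n) f≤g = +-mono-≤ (f≤g 0) (∑-mono-≤ n (f≤g ∘ suc))

∑-+ : ∀ m n (f : ℕ → ℕ) → ∑< (m + n) f ≡ ∑< m f + ∑[ i < n ] f (m + i)
∑-+ zero    n f = refl
∑-+ (suc m) n f = trans (cong (f 0 +_) (∑-+ m n (f ∘ suc))) (sym (+-assoc (f 0) _ _))

∑-* : ∀ q P (f : ℕ → ℕ) → ∑< (q * P) f ≡ ∑[ j < q ] ∑[ i < P ] f (j * P + i)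
∑-* zero    P f = refl
∑-* (suc q) P f = trans (∑-+ P (q * P) f) (cong (∑< P f +_) (trans (∑-* q P (λ i → f (P + i)))
  (∑-cong q (λ j → ∑-cong P (λ i → cong f (sym (+-assoc P (j * P) i)))))))

∑-distrib-+ : ∀ n (f g : ℕ → ℕ) → ∑[ i < n ] (f i + g i) ≡ ∑< n f + ∑< n g
∑-distrib-+ zero    f g = refl
∑-distrib-+ (suc n) f g = trans (cong (f 0 + g 0 +_) (∑-distrib-+ n (f ∘ suc) (g ∘ suc)))
  (+.interchange (f 0) (g 0) (∑< n (f ∘ suc)) (∑< n (g ∘ suc)))

∑-zero : ∀ n → ∑[ i < n ] 0 ≡ 0
∑-zero zero    = refl
∑-zero (suc n) = ∑-zero n

∑-comm : ∀ m n (f : ℕ → ℕ → ℕ) → ∑[ j < m ] ∑[ i < n ] f j i ≡ ∑[ i < n ] ∑[ j < m ] f j i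
∑-comm zero    n f = sym (∑-zero n)
∑-comm (suc m) n f = trans (cong (∑< n (f 0) +_) (∑-comm m n (f ∘ suc)))
  (sym (∑-distrib-+ n (f 0) (λ i → ∑[ j < m ] f (suc j) i)))

∑-*ˡ : ∀ n c (f : ℕ → ℕ) → ∑[ i < n ] (c * f i) ≡ c * ∑< n f
∑-*ˡ zero    c f = sym (*-zeroʳ c)
∑-*ˡ (suc n) c f = trans (cong (c * f 0 +_) (∑-*ˡ n c (f ∘ suc))) (sym (*-distribˡ-+ c (f 0) _))

∑-const : ∀ n c → ∑[ i < n ] c ≡ n * c
∑-const zero    c = refl
∑-const (suc n) c = cong (c +_) (∑-const n c)

∑-≥-term : ∀ n (f : ℕ → ℕ) {j} → j < n → f j ≤ ∑< n f
∑-≥-term (suc n) f {zero}  _         = m≤m+n (f 0) _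
∑-≥-term (suc n) f {suc j} (s≤s j<n) = ≤-trans (∑-≥-term n (f ∘ suc) j<n) (m≤n+m _ (f 0))

∑-mono-range : ∀ {m n} (f : ℕ → ℕ) → m ≤ n → ∑< m f ≤ ∑< n f
∑-mono-range {m} {n} f m≤n = begin
  ∑< m f                                ≤⟨ m≤m+n (∑< m f) _ ⟩
  ∑< m f + ∑[ i < n ∸ m ] f (m + i)     ≡⟨ ∑-+ m (n ∸ m) f ⟨
  ∑< (m + (n ∸ m)) f                    ≡⟨ cong (λ k → ∑< k f) (m+[n∸m]≡n m≤n) ⟩
  ∑< n f                                ∎
  where open ≤-Reasoning

∑-complement : ∀ n {f : ℕ → ℕ} → (∀ i → f i ≤ 1) → ∑[ i < n ] (1 ∸ f i) + ∑< n f ≡ n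
∑-complement n {f} f≤1 = begin
  ∑[ i < n ] (1 ∸ f i) + ∑< n f   ≡⟨ ∑-distrib-+ n (λ i → 1 ∸ f i) f ⟨
  ∑[ i < n ] (1 ∸ f i + f i)      ≡⟨ ∑-cong n (λ i → m∸n+n≡m (f≤1 i)) ⟩
  ∑[ i < n ] 1                    ≡⟨ ∑-const n 1 ⟩
  n * 1                           ≡⟨ *-identityʳ n ⟩
  n                               ∎
  where open ≡-Reasoning

∑-windows : ∀ {P C} .{{_ : NonZero P}} (f : ℕ → ℕ) → (∀ s → ∑[ i < P ] f (s + i) ≤ C) →
  ∀ n → ∑< n f ≤ (n / P + 1) * C
∑-windows {P} {C} f window n = begin
  ∑< n f                                           ≤⟨ ∑-mono-range f n≤blocks ⟩
  ∑< ((n / P + 1) * P) f                           ≡⟨ ∑-* (n / P + 1) P f ⟩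
  ∑[ j < n / P + 1 ] ∑[ i < P ] f (j * P + i)      ≤⟨ ∑-mono-≤ (n / P + 1) (λ j → window (j * P)) ⟩
  ∑[ j < n / P + 1 ] C                             ≡⟨ ∑-const (n / P + 1) C ⟩
  (n / P + 1) * C                                  ∎
  where
  open ≤-Reasoning
  n≤blocks : n ≤ (n / P + 1) * P
  n≤blocks = begin
    n                    ≡⟨ m≡m%n+[m/n]*n n P ⟩
    n % P + n / P * P    ≤⟨ +-monoˡ-≤ (n / P * P) (<⇒≤ (m%n<n n P)) ⟩
    P + n / P * P        ≡⟨ +-comm P (n / P * P) ⟩
    n / P * P + P        ≡⟨ cong (n / P * P +_) (*-identityˡ P) ⟨
    n / P * P + 1 * P    ≡⟨ *-distribʳ-+ P (n / P) 1 ⟨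
    (n / P + 1) * P      ∎

δ : ℕ → ℕ → ℕ
δ y r with y ≟ r
... | yes _ = 1
... | no  _ = 0

δ-refl : ∀ y → δ y y ≡ 1
δ-refl y with y ≟ y
... | yes _   = refl
... | no  y≢y = ⊥-elim (y≢y refl)

hits : ℕ → List ℕ → ℕ
hits y rs = sum (map (δ y) rs)

hits-∉ : ∀ {y rs} → All (y ≢_) rs → hits y rs ≡ 0
hits-∉ []                         = refl
hits-∉ {y} {r ∷ _} (y≢r ∷ y≢rs) with y ≟ r
... | yes y≡r = ⊥-elim (y≢r y≡r)
... | no  _   = hits-∉ y≢rs

hits-≤1 : ∀ y {rs} → Unique rs → hits y rs ≤ 1
hits-≤1 y []                            = z≤n
hits-≤1 y {r ∷ _} (r≢rs ∷ unique) with y ≟ r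
... | yes refl = s≤s (≤-reflexive (hits-∉ r≢rs))
... | no  _    = hits-≤1 y unique

hits>0⇒∈ : ∀ {y rs} → 0 < hits y rs → y ∈ rs
hits>0⇒∈ {y} {r ∷ _} hit with y ≟ r
... | yes y≡r = here y≡r
... | no  _   = there (hits>0⇒∈ hit)

∑-hits : ∀ {p rs} (g : ℕ → ℕ) → All (_< p) rs → (∀ {r} → r < p → ∃ λ j → j < p × g j ≡ r) →
  length rs ≤ ∑[ j < p ] hits (g j) rs
∑-hits                g []           onto = z≤n
∑-hits {p} {r ∷ rs} g (r<p ∷ rs<p) onto = begin
  suc (length rs)
    ≤⟨ +-mono-≤ hit-r (∑-hits g rs<p onto) ⟩
  ∑[ j < p ] δ (g j) r + ∑[ j < p ] hits (g j) rs
    ≡⟨ ∑-distrib-+ p (λ j → δ (g j) r) (λ j → hits (g j) rs) ⟨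
  ∑[ j < p ] hits (g j) (r ∷ rs) ∎
  where
  open ≤-Reasoning
  hit-r : 1 ≤ ∑[ j < p ] δ (g j) r
  hit-r with onto r<p
  ... | j , j<p , refl = ≤-trans (≤-reflexive (sym (δ-refl (g j)))) (∑-≥-term p (λ j → δ (g j) r) j<p)

module _ {p : ℕ} .{{_ : NonZero p}} where

  mod-+-congʳ : ∀ x {a b} → a % p ≡ b % p → (x + a) % p ≡ (x + b) % p
  mod-+-congʳ x {a} {b} a≡b = begin
    (x + a) % p              ≡⟨ %-distribˡ-+ x a p ⟩
    (x % p + a % p) % p      ≡⟨ cong (λ u → (x % p + u) % p) a≡b ⟩
    (x % p + b % p) % p      ≡⟨ %-distribˡ-+ x b p ⟨
    (x + b) % p              ∎
    where open ≡-Reasoning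

  mod-*-congʳ : ∀ x {a b} → a % p ≡ b % p → (x * a) % p ≡ (x * b) % p
  mod-*-congʳ x {a} {b} a≡b = begin
    (x * a) % p              ≡⟨ %-distribˡ-* x a p ⟩
    (x % p * (a % p)) % p    ≡⟨ cong (λ u → (x % p * u) % p) a≡b ⟩
    (x % p * (b % p)) % p    ≡⟨ %-distribˡ-* x b p ⟨
    (x * b) % p              ∎
    where open ≡-Reasoning

  translates-onto : ∀ {w P} → (w * P) % p ≡ 1 → ∀ x {r} → r < p → ∃ λ j → j < p × (x + j * P) % p ≡ r
  translates-onto {w} {P} wP≡1 x {r} r<p = j , m%n<n (w * z) p , (begin
    (x + j * P) % p          ≡⟨ mod-+-congʳ x jP≡z ⟩
    (x + z) % p              ≡⟨ cong (_% p) (x+z≡r+x*p) ⟩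
    (r + x * p) % p          ≡⟨ [m+kn]%n≡m%n r x p ⟩
    r % p                    ≡⟨ m<n⇒m%n≡m r<p ⟩
    r                        ∎)
    where
    open ≡-Reasoning
    -- x + z ≡ r and j P ≡ z modulo p
    z j : ℕ
    z = r + x * pred p
    j = (w * z) % p
    1%p≡1 : 1 % p ≡ 1
    1%p≡1 = trans (cong (_% p) (sym wP≡1)) (trans (m%n%n≡m%n (w * P) p) wP≡1)
    jP≡z : (j * P) % p ≡ z % p
    jP≡z = begin
      (j * P) % p            ≡⟨ cong (_% p) (*-comm j P) ⟩
      (P * j) % p            ≡⟨ mod-*-congʳ P (m%n%n≡m%n (w * z) p) ⟩
      (P * (w * z)) % p      ≡⟨ cong (_% p) (*.x∙yz≈z∙yx P w z) ⟩
      (z * (w * P)) % p      ≡⟨ mod-*-congʳ z (trans wP≡1 (sym 1%p≡1)) ⟩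
      (z * 1) % p            ≡⟨ cong (_% p) (*-identityʳ z) ⟩
      z % p                  ∎
    x+z≡r+x*p : x + z ≡ r + x * p
    x+z≡r+x*p = begin
      x + (r + x * pred p)   ≡⟨ regroup x r (pred p) ⟩
      r + x * suc (pred p)   ≡⟨ cong (λ q → r + x * q) (suc-pred p) ⟩
      r + x * p              ∎
      where
      regroup : ∀ x r q → x + (r + x * q) ≡ r + x * suc q
      regroup = solve-∀

  ∑-uncovered-translates : ∀ {w P rs} → (w * P) % p ≡ 1 → All (_< p) rs → Unique rs → ∀ x →
    ∑[ j < p ] (1 ∸ hits ((x + j * P) % p) rs) ≤ p ∸ length rs
  ∑-uncovered-translates {w} {P} {rs} wP≡1 rs<p unique x = begin
    ∑[ j < p ] (1 ∸ h j)                    ≡⟨ m+n∸n≡m _ (∑< p h) ⟨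
    ∑[ j < p ] (1 ∸ h j) + ∑< p h ∸ ∑< p h  ≡⟨ cong (_∸ ∑< p h) (∑-complement p (λ _ → hits-≤1 _ unique)) ⟩
    p ∸ ∑< p h                              ≤⟨ ∸-monoʳ-≤ p (∑-hits g rs<p (translates-onto {w} wP≡1 x)) ⟩
    p ∸ length rs                           ∎
    where
    open ≤-Reasoning
    g : ℕ → ℕ
    g j = (x + j * P) % p
    h : ℕ → ℕ
    h j = hits (g j) rs

-- The sieve

record Layer : Set where
  constructor layer
  field
    modulus : ℕ
    {{modulus≢0}} : NonZero modulus
    -- an inverse, modulo this modulus, of the product of the moduli of all later layers
    inverse : ℕ
    families : List Family

residues : List Family → List ℕ
residues = map Family.residue

uncovered : Layer → ℕ → ℕ
uncovered (layer p _ fs) y = 1 ∸ hits (y % p) (residues fs)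

survives : List Layer → ℕ → ℕ
survives []      y = 1
survives (ℓ ∷ L) y = uncovered ℓ y * survives L y

period : List Layer → ℕ
period []                = 1
period (layer p _ _ ∷ L) = p * period L

survivorCount : List Layer → ℕ
survivorCount []                 = 1
survivorCount (layer p _ fs ∷ L) = (p ∸ length (residues fs)) * survivorCount L

WellFormed : List Layer → Set
WellFormed []                 = ⊤
WellFormed (layer p w fs ∷ L) =
  (w * period L) % p ≡ 1 × All (_< p) (residues fs) × Unique (residues fs) ×
  All (IsCycleFamily p) fs × WellFormed L

wellFormed? : ∀ L → Dec (WellFormed L)
wellFormed? []                 = yes tt
wellFormed? (layer p w fs ∷ L) =
  (w * period L) % p ≟ 1 ×-dec All.all? (_<? p) (residues fs) ×-dec unique? (residues fs) ×-dec
  All.all? (isCycleFamily? p) fs ×-dec wellFormed? L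

period≢0 : ∀ L → NonZero (period L)
period≢0 []                          = _
period≢0 (layer p {{p≢0}} _ _ ∷ L) = m*n≢0 p (period L) {{p≢0}} {{period≢0 L}}

uncovered-periodic : ∀ ℓ y k → uncovered ℓ (y + k * Layer.modulus ℓ) ≡ uncovered ℓ y
uncovered-periodic (layer p _ fs) y k = cong (λ u → 1 ∸ hits u (residues fs)) ([m+kn]%n≡m%n y k p)

survives-periodic : ∀ L y j → survives L (y + j * period L) ≡ survives L y
survives-periodic []                     y j = refl
survives-periodic (ℓ@(layer p _ _) ∷ L) y j = cong₂ _*_
  (trans (cong (uncovered ℓ ∘ (y +_)) (*.x∙yz≈xz∙y j p (period L))) (uncovered-periodic ℓ y (j * period L)))
  (trans (cong (survives L ∘ (y +_)) (sym (*-assoc j p (period L)))) (survives-periodic L y (j * p)))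

-- Cut the window into p blocks of length P: the i-th entries of the blocks agree on survival under
-- L, and they form the translates s + i + j P, which meet every residue class modulo p once.
∑-survives-window : ∀ L → WellFormed L → ∀ s → ∑[ i < period L ] survives L (s + i) ≤ survivorCount L
∑-survives-window [] _ s = ≤-refl
∑-survives-window (ℓ@(layer p w fs) ∷ L) (wP≡1 , rs<p , unique , _ , wf) s = begin
  ∑[ i < p * P ] survives (ℓ ∷ L) (s + i)
    ≡⟨ ∑-* p P (λ i → survives (ℓ ∷ L) (s + i)) ⟩
  ∑[ j < p ] ∑[ i < P ] survives (ℓ ∷ L) (s + (j * P + i))
    ≡⟨ ∑-cong p (λ j → ∑-cong P (λ i → split j i)) ⟩
  ∑[ j < p ] ∑[ i < P ] (survives L (s + i) * uncovered ℓ (s + i + j * P))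
    ≡⟨ ∑-comm p P (λ j i → survives L (s + i) * uncovered ℓ (s + i + j * P)) ⟩
  ∑[ i < P ] ∑[ j < p ] (survives L (s + i) * uncovered ℓ (s + i + j * P))
    ≡⟨ ∑-cong P (λ i → ∑-*ˡ p (survives L (s + i)) (λ j → uncovered ℓ (s + i + j * P))) ⟩
  ∑[ i < P ] (survives L (s + i) * ∑[ j < p ] uncovered ℓ (s + i + j * P))
    ≤⟨ ∑-mono-≤ P (λ i → *-monoʳ-≤ (survives L (s + i)) (uncovered-translates (s + i))) ⟩
  ∑[ i < P ] (survives L (s + i) * (p ∸ length (residues fs)))
    ≡⟨ ∑-cong P (λ i → *-comm (survives L (s + i)) _) ⟩
  ∑[ i < P ] ((p ∸ length (residues fs)) * survives L (s + i))
    ≡⟨ ∑-*ˡ P (p ∸ length (residues fs)) (λ i → survives L (s + i)) ⟩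
  (p ∸ length (residues fs)) * ∑[ i < P ] survives L (s + i)
    ≤⟨ *-monoʳ-≤ (p ∸ length (residues fs)) (∑-survives-window L wf s) ⟩
  (p ∸ length (residues fs)) * survivorCount L ∎
  where
  open ≤-Reasoning
  P : ℕ
  P = period L
  uncovered-translates : ∀ x → ∑[ j < p ] uncovered ℓ (x + j * P) ≤ p ∸ length (residues fs)
  uncovered-translates = ∑-uncovered-translates {w = w} wP≡1 rs<p unique
  split : ∀ j i → survives (ℓ ∷ L) (s + (j * P + i)) ≡ survives L (s + i) * uncovered ℓ (s + i + j * P)
  split j i rewrite +.x∙yz≈xz∙y s (j * P) i | survives-periodic L (s + i) j =
    *-comm (uncovered ℓ (s + i + j * P)) (survives L (s + i))

survives≡0⇒PB2 : ∀ L → WellFormed L → ∀ {b} → survives L b ≡ 0 → PB2 b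
survives≡0⇒PB2 (ℓ@(layer p _ fs) ∷ L) (_ , _ , _ , cycleFamilies , wf) {b} sieved
  with m*n≡0⇒m≡0∨n≡0 (uncovered ℓ b) sieved
... | inj₂ sievedByL = survives≡0⇒PB2 L wf sievedByL
... | inj₁ covered with All.lookupAny cycleFamilies (Anyₚ.map⁻ (hits>0⇒∈ (m∸n≡0⇒m≤n covered)))
...   | isCycleFamily , b%p≡r = residueClass⇒PB2 _ isCycleFamily b%p≡r

density-arith : ∀ {k n m u Q C} p r → (p + r) * C ≤ r * Q → u * Q ≤ n → n ≤ m + (u + 1) * C → k * C ≤ n →
  p * k * n ≤ (p + r) * k * m + (p + r) * n
density-arith {k} {n} {m} {u} {Q} {C} p r qC≤rQ uQ≤n n≤m+[u+1]C kC≤n =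
  +-cancelʳ-≤ (r * (k * n)) (p * k * n) _ (begin
    p * k * n + r * (k * n)              ≡⟨ factor-k p r k n ⟩
    k * (q * n)                          ≤⟨ *-monoʳ-≤ k qn≤ ⟩
    k * (q * m + r * n + q * C)          ≡⟨ distrib-k q k m r n C ⟩
    q * k * m + r * (k * n) + q * (k * C) ≤⟨ +-monoʳ-≤ (q * k * m + r * (k * n)) (*-monoʳ-≤ q kC≤n) ⟩
    q * k * m + r * (k * n) + q * n      ≡⟨ +.xy∙z≈xz∙y (q * k * m) (r * (k * n)) (q * n) ⟩
    q * k * m + q * n + r * (k * n)      ∎)
  where
  open ≤-Reasoning
  factor-k : ∀ p r k n → p * k * n + r * (k * n) ≡ k * ((p + r) * n)
  factor-k = solve-∀
  distrib-k : ∀ q k m r n C → k * (q * m + r * n + q * C) ≡ q * k * m + r * (k * n) + q * (k * C)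
  distrib-k = solve-∀
  distrib-q : ∀ q m u C → q * (m + (u + 1) * C) ≡ q * m + q * (u * C) + q * C
  distrib-q = solve-∀
  q : ℕ
  q = p + r
  quC≤rn : q * (u * C) ≤ r * n
  quC≤rn = begin
    q * (u * C)    ≡⟨ *.x∙yz≈y∙xz q u C ⟩
    u * (q * C)    ≤⟨ *-monoʳ-≤ u qC≤rQ ⟩
    u * (r * Q)    ≡⟨ *.x∙yz≈y∙xz u r Q ⟩
    r * (u * Q)    ≤⟨ *-monoʳ-≤ r uQ≤n ⟩
    r * n          ∎
  qn≤ : q * n ≤ q * m + r * n + q * C
  qn≤ = begin
    q * n                          ≤⟨ *-monoʳ-≤ q n≤m+[u+1]C ⟩
    q * (m + (u + 1) * C)          ≡⟨ distrib-q q m u C ⟩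
    q * m + q * (u * C) + q * C    ≤⟨ +-monoˡ-≤ (q * C) (+-monoʳ-≤ (q * m) quC≤rn) ⟩
    q * m + r * n + q * C          ∎

lowerDensity-from-count : ∀ {P : ℕ → Set} {Q C} .{{_ : NonZero Q}} p r → (p + r) * C ≤ r * Q →
  (∀ n → Σ ℕ λ m → AtLeastInRange P n m × n ≤ m + (n / Q + 1) * C) → LowerDensityAtLeast P p (p + r)
-- The threshold k C works for every k.
lowerDensity-from-count {Q = Q} {C} p r qC≤rQ count k _ = k * C , λ n kC≤n →
  let (m , atLeast , n≤) = count n
  in m , atLeast , density-arith {u = n / Q} p r qC≤rQ (m/n*n≤m n Q) n≤ kC≤n

length≤length-filter+sum : ∀ {A : Set} (f : A → ℕ) xs →
  length xs ≤ length (filter (λ x → f x ≟ 0) xs) + sum (map f xs)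
length≤length-filter+sum f []       = z≤n
length≤length-filter+sum f (x ∷ xs) with f x
... | zero  = s≤s (length≤length-filter+sum f xs)
... | suc k = begin
  suc (length xs)                ≤⟨ s≤s (length≤length-filter+sum f xs) ⟩
  suc (F + sum (map f xs))       ≡⟨ +-suc F _ ⟨
  F + suc (sum (map f xs))       ≤⟨ +-monoʳ-≤ F (s≤s (m≤n+m _ k)) ⟩
  F + suc (k + sum (map f xs))   ∎
  where
  open ≤-Reasoning
  F : ℕ
  F = length (filter (λ x → f x ≟ 0) xs)

module _ (L : List Layer) (wf : WellFormed L) where

  instance
    period-nonZero : NonZero (period L)
    period-nonZero = period≢0 L

  sieve-count : ∀ n → Σ ℕ λ m → AtLeastInRange PB2 n m × n ≤ m + (n / period L + 1) * survivorCount L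
  sieve-count n = length sievedOut , (sievedOut , unique , inRange , ≤-refl) , (begin
    n
      ≡⟨ length-applyUpTo suc n ⟨
    length candidates
      ≤⟨ length≤length-filter+sum (survives L) candidates ⟩
    length sievedOut + sum (map (survives L) candidates)
      ≡⟨ cong (λ xs → length sievedOut + sum xs) (map-applyUpTo suc (survives L) n) ⟩
    length sievedOut + ∑[ i < n ] survives L (suc i)
      ≤⟨ +-monoʳ-≤ (length sievedOut) (∑-windows (survives L ∘ suc) (∑-survives-window L wf ∘ suc) n) ⟩
    length sievedOut + (n / period L + 1) * survivorCount L ∎)
    where
    open ≤-Reasoning
    candidates : List ℕ
    candidates = applyUpTo suc n
    sievedOut? : Decidable (λ b → survives L b ≡ 0)
    sievedOut? b = survives L b ≟ 0
    sievedOut : List ℕ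
    sievedOut = filter sievedOut? candidates
    unique : Unique sievedOut
    unique = Uniqueₚ.filter⁺ sievedOut? (Uniqueₚ.applyUpTo⁺₁ suc n (λ i<j _ → <⇒≢ (s≤s i<j)))
    candidates-inRange : All (λ b → 1 ≤ b × b ≤ n) candidates
    candidates-inRange = Allₚ.applyUpTo⁺₁ suc n (λ i<n → s≤s z≤n , i<n)
    inRange : All (λ b → 1 ≤ b × b ≤ n × PB2 b) sievedOut
    inRange = All.map (λ ((1≤b , b≤n) , b-sievedOut) → 1≤b , b≤n , survives≡0⇒PB2 L wf b-sievedOut)
      (All.zip (Allₚ.filter⁺ sievedOut? candidates-inRange , Allₚ.all-filter sievedOut? candidates))

  sieve-lowerDensity : ∀ p r → (p + r) * survivorCount L ≤ r * period L → LowerDensityAtLeast PB2 p (p + r)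
  sieve-lowerDensity p r density = lowerDensity-from-count p r density sieve-count

sieve : List Layer
sieve =
  layer 5 2 (family 3 1 1 2 1 3 2 1 0 ∷ []) ∷
  layer 17 11 (family 8 3 2 5 3 9 5 2 1 ∷ family 15 1 1 13 12 11 10 10 9 ∷ []) ∷
  layer 29 21 (family 12 2 1 5 2 12 5 1 0 ∷ []) ∷
  layer 41 25 (family 9 5 2 37 8 19 5 34 7 ∷ []) ∷
  layer 53 11 (family 24 8 4 25 12 34 16 13 6 ∷ family 42 6 5 32 26 36 29 20 16 ∷ []) ∷
  layer 73 6 (family 46 11 7 5 3 19 12 2 1 ∷ []) ∷
  layer 101 88 (family 31 37 12 34 11 53 17 25 8 ∷ family 88 33 29 74 65 57 50 65 57 ∷ []) ∷
  layer 109 1 (family 33 3 1 10 3 33 10 1 0 ∷ []) ∷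
  layer 113 2 (family 98 3 3 45 39 69 60 18 15 ∷ []) ∷
  layer 137 19 (family 14 6 1 52 6 82 9 20 2 ∷ family 100 6 5 85 62 94 69 53 38 ∷ []) ∷
  layer 157 76 (family 129 46 38 32 26 68 56 20 16 ∷ []) ∷
  layer 173 150 (family 84 2 1 160 78 76 37 148 72 ∷ family 138 24 20 17 14 54 44 5 4 ∷ []) ∷
  layer 181 125 (family 162 35 32 122 109 119 107 89 79 ∷ []) ∷
  layer 197 84 (family 14 8 1 85 6 124 9 37 2 ∷ family 54 29 8 185 51 69 19 178 49 ∷
                family 135 41 29 17 12 57 40 10 7 ∷ []) ∷
  layer 233 206 (family 89 19 8 173 66 153 59 130 49 ∷ []) ∷
  layer 241 182 (family 64 47 13 125 33 157 42 74 19 ∷ []) ∷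
  layer 281 117 (family 53 33 7 218 41 177 34 173 32 ∷ family 89 17 6 58 19 127 41 13 4 ∷ []) ∷
  layer 293 284 (family 61 76 16 233 49 162 34 205 43 ∷ family 269 94 87 80 74 144 133 52 48 ∷ []) ∷
  layer 317 254 (family 203 3 2 25 16 89 57 2 1 ∷ []) ∷
  layer 337 262 (family 148 111 49 85 37 159 70 58 25 ∷ []) ∷
  layer 349 123 (family 213 10 7 313 191 174 107 281 171 ∷ []) ∷
  layer 353 312 (family 42 66 8 52 6 134 16 20 2 ∷ []) ∷
  layer 397 131 (family 334 69 59 377 317 113 96 370 311 ∷ []) ∷
  layer 401 276 (family 82 173 36 149 31 207 43 130 27 ∷
                 family 357 167 149 269 240 213 190 250 223 ∷ []) ∷
  layer 409 350 (family 143 3 2 389 136 149 53 370 129 ∷ family 167 37 16 26 11 103 43 5 2 ∷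
                 family 266 17 12 386 251 157 103 365 237 ∷ []) ∷
  layer 421 346 (family 29 127 9 106 7 201 14 65 4 ∷ []) ∷
  layer 461 306 (family 413 108 97 113 101 222 199 53 47 ∷ []) ∷
  layer 509 337 (family 301 27 16 17 10 93 55 2 1 ∷ []) ∷
  layer 521 121 (family 235 177 80 85 38 197 89 74 33 ∷ family 286 57 32 370 203 347 191 269 147 ∷ []) ∷
  layer 541 258 (family 489 193 175 298 269 327 296 233 210 ∷ []) ∷
  layer 557 377 (family 439 110 87 169 133 298 235 73 57 ∷ []) ∷
  layer 577 317 (family 24 84 4 292 12 378 16 160 6 ∷ family 553 174 167 137 131 268 257 85 81 ∷ []) ∷
  layer 593 317 (family 256 36 16 193 84 332 144 65 28 ∷ family 516 36 32 400 348 404 352 272 236 ∷ []) ∷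
  layer 601 334 (family 125 141 30 405 84 387 81 306 63 ∷ []) ∷
  layer 641 171 (family 78 202 25 340 42 398 49 244 30 ∷ family 154 93 23 421 101 431 104 290 69 ∷
                 family 452 198 140 365 258 402 284 269 190 ∷ []) ∷
  layer 661 278 (family 106 195 32 482 77 389 63 409 65 ∷ []) ∷
  layer 673 543 (family 615 176 161 113 103 268 245 65 59 ∷ []) ∷
  layer 677 93 (family 116 267 46 505 87 331 57 482 83 ∷ family 321 279 133 193 92 319 152 170 81 ∷
                family 651 111 107 178 171 341 328 65 62 ∷ []) ∷
  layer 701 317 (family 135 5 1 26 5 135 26 1 0 ∷ family 566 53 43 145 117 317 256 34 27 ∷ []) ∷
  layer 709 579 (family 613 147 128 641 554 287 249 610 527 ∷ []) ∷
  layer 733 506 (family 380 103 54 442 229 495 257 281 145 ∷ []) ∷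
  layer 757 45 (family 397 41 22 218 115 401 211 65 34 ∷ family 670 67 60 530 469 509 451 377 333 ∷ []) ∷
  layer 769 306 (family 62 108 9 225 18 408 33 81 6 ∷ []) ∷
  layer 773 555 (family 456 114 68 580 342 494 292 452 266 ∷ []) ∷
  layer 797 636 (family 215 51 14 193 52 389 105 50 13 ∷ family 582 59 44 730 533 359 263 673 491 ∷ []) ∷
  layer 809 111 (family 318 81 32 130 51 323 127 29 11 ∷ family 491 114 70 656 398 480 292 548 332 ∷
                 family 591 15 11 725 530 405 296 650 475 ∷
                 family 642 125 100 109 87 295 235 34 27 ∷ []) ∷
  layer 821 615 (family 526 268 172 244 156 418 268 160 102 ∷ []) ∷
  layer 853 649 (family 333 288 113 485 189 524 205 373 145 ∷ []) ∷
  layer 857 48 (family 207 54 14 820 198 286 70 788 190 ∷ family 525 54 34 37 23 178 110 5 3 ∷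
                family 650 119 91 637 483 553 420 490 371 ∷
                family 702 284 233 512 420 528 433 400 328 ∷
                family 763 296 264 425 379 516 460 313 279 ∷ []) ∷
  layer 877 417 (family 726 64 53 17 14 122 101 5 4 ∷ []) ∷
  layer 929 895 (family 324 117 41 181 63 407 142 50 17 ∷ family 605 227 148 157 102 373 243 82 53 ∷ []) ∷
  layer 937 546 (family 741 433 343 538 425 495 392 509 402 ∷ []) ∷
  layer 941 769 (family 97 29 3 10 1 97 10 1 0 ∷ family 844 40 36 116 104 330 296 16 14 ∷ []) ∷
  layer 953 138 (family 511 147 79 170 91 399 214 53 28 ∷ []) ∷
  layer 977 548 (family 252 374 97 521 134 576 149 421 108 ∷ []) ∷
  layer 997 2 (family 164 24 4 873 144 534 88 765 126 ∷ family 383 162 63 160 62 396 153 52 20 ∷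
               family 836 191 161 841 705 531 446 746 625 ∷ []) ∷
  layer 1009 466 (family 469 303 141 162 75 387 180 117 54 ∷ []) ∷
  layer 1033 520 (family 231 409 92 458 103 583 131 365 82 ∷
                  family 398 391 151 650 251 601 232 557 215 ∷ []) ∷
  layer 1049 204 (family 166 195 31 850 135 605 96 725 115 ∷ family 586 27 16 37 21 197 111 2 1 ∷
                  family 623 123 74 997 592 347 207 962 571 ∷
                  family 752 285 205 274 197 515 370 149 107 ∷ []) ∷
  layer 1061 742 (family 103 92 9 73 7 278 27 13 1 ∷ family 958 40 37 937 846 554 501 829 748 ∷ []) ∷
  layer 1093 371 (family 563 209 108 377 194 619 319 170 87 ∷ []) ∷
  layer 1097 423 (family 341 324 101 313 97 556 173 185 57 ∷ []) ∷
  layer 1109 778 (family 354 97 31 41 13 213 68 10 3 ∷ []) ∷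
  layer 1129 448 (family 961 292 249 509 433 694 591 305 259 ∷ []) ∷
  layer 1153 126 (family 140 201 25 685 83 771 94 442 53 ∷
                  family 1013 96 85 757 665 786 691 505 443 ∷ []) ∷
  layer 1201 50 (family 1152 288 277 901 864 726 697 745 714 ∷ []) ∷
  layer 1213 878 (family 495 171 70 265 108 561 229 82 33 ∷
                  family 718 11 7 593 351 797 472 290 171 ∷ []) ∷
  layer 1217 1095 (family 1139 254 238 340 318 626 586 148 138 ∷ []) ∷
  layer 1229 124 (family 597 193 94 305 148 603 293 106 51 ∷
                  family 632 111 58 1130 581 537 277 1049 539 ∷
                  family 836 288 196 1105 752 482 328 1061 722 ∷
                  family 1057 342 295 160 138 428 369 116 100 ∷ []) ∷
  layer 1249 928 (family 664 265 141 149 79 425 226 74 39 ∷ []) ∷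
  layer 1277 716 (family 113 169 15 58 5 271 24 25 2 ∷ family 991 41 32 802 623 877 681 505 392 ∷
                  family 1085 129 110 530 451 789 671 233 198 ∷ []) ∷
  layer 1289 202 (family 38 292 9 656 20 828 25 400 12 ∷ family 441 268 92 761 261 852 292 505 173 ∷
                  family 479 198 74 544 202 796 296 260 96 ∷ []) ∷
  layer 1297 939 (family 36 172 5 293 8 610 17 89 2 ∷ family 1261 99 97 970 943 849 826 733 712 ∷ []) ∷
  layer 1301 449 (family 51 184 8 1024 40 800 32 832 32 ∷
                  family 1250 453 436 986 947 681 655 905 869 ∷ []) ∷
  layer 1321 17 (family 1064 323 261 1109 893 667 538 1010 813 ∷ []) ∷
  layer 1373 1158 (family 705 87 45 450 231 771 396 153 78 ∷ []) ∷
  layer 1381 95 (family 366 135 36 306 81 645 171 81 21 ∷ []) ∷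
  layer 1429 679 (family 809 589 334 785 444 817 463 674 381 ∷ []) ∷
  layer 1453 260 (family 254 149 27 50 9 269 48 17 3 ∷ family 698 473 228 305 147 629 303 218 105 ∷
                  family 921 41 26 1418 899 377 239 1385 878 ∷
                  family 956 361 238 698 459 913 601 425 279 ∷
                  family 1351 401 373 1217 1132 701 652 1130 1051 ∷ []) ∷
  layer 1481 689 (family 465 204 65 1405 441 478 151 1361 427 ∷
                  family 1016 322 221 149 102 462 317 85 58 ∷ []) ∷
  layer 1493 400 (family 432 398 116 1252 362 730 212 1156 334 ∷
                  family 1061 121 86 17 12 159 113 10 7 ∷ []) ∷
  layer 1597 1047 (family 987 94 59 1445 893 764 473 1313 811 ∷ []) ∷
  layer 1601 804 (family 379 363 86 1490 353 477 113 1469 348 ∷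
                  family 452 397 113 130 37 443 126 109 31 ∷
                  family 1561 456 445 629 613 930 907 377 367 ∷ []) ∷
  layer 1609 1294 (family 47 507 15 1285 38 813 24 1186 35 ∷
                   family 523 167 55 1154 375 1069 348 845 274 ∷
                   family 582 573 208 405 147 747 271 306 111 ∷ []) ∷
  layer 1613 1526 (family 589 23 9 305 112 699 256 58 21 ∷
                   family 1486 289 267 1217 1121 1011 932 970 893 ∷ []) ∷
  layer 1621 1495 (family 1455 89 80 185 166 547 491 26 23 ∷ []) ∷
  layer 1637 1437 (family 316 248 48 208 40 580 112 64 12 ∷ []) ∷
  layer 1669 1230 (family 220 5 1 569 75 955 126 194 25 ∷
                   family 1449 603 524 809 702 989 859 610 529 ∷ []) ∷
  layer 1693 683 (family 92 384 21 225 12 606 33 117 6 ∷ []) ∷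
  layer 1721 1161 (family 1248 73 53 109 79 433 314 10 7 ∷ []) ∷
  layer 1733 404 (family 1323 423 323 130 99 461 352 113 86 ∷ []) ∷
  layer 1753 1063 (family 713 389 159 1370 557 1031 420 1157 470 ∷ []) ∷
  layer 1777 167 (family 1002 55 32 1754 989 337 191 1733 977 ∷ []) ∷
  layer 1789 41 (family 724 396 161 1325 536 1108 449 1069 432 ∷ []) ∷
  layer 1801 1581 (family 824 633 290 698 319 1007 461 493 225 ∷
                   family 977 584 317 349 189 750 407 257 139 ∷ []) ∷
  layer 1873 616 (family 737 106 42 544 214 996 392 164 64 ∷ []) ∷
  layer 1877 1536 (family 1740 1 1 137 127 507 470 10 9 ∷ []) ∷
  layer 1889 197 (family 331 123 22 845 148 1203 211 386 67 ∷ []) ∷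
  layer 1901 775 (family 218 303 35 481 55 941 108 170 19 ∷ []) ∷
  layer 1913 1626 (family 1113 506 295 628 366 1042 607 340 198 ∷
                   family 1858 354 344 1445 1404 1194 1160 1157 1124 ∷ []) ∷
  layer 1949 243 (family 1360 218 153 1717 1198 992 693 1537 1072 ∷
                  family 1834 132 125 212 200 642 605 32 30 ∷ []) ∷
  layer 1993 1764 (family 164 192 16 1305 108 1356 112 873 72 ∷
                   family 717 324 117 832 300 1224 441 400 144 ∷
                   family 834 579 243 1413 591 1203 504 1170 489 ∷
                   family 1159 174 102 1620 942 1206 702 1332 774 ∷
                   family 1573 174 138 373 295 858 678 85 67 ∷ []) ∷
  layer 2017 1476 (family 1469 499 364 698 509 1129 823 365 266 ∷
                   family 1579 337 264 1490 1167 1291 1011 1157 906 ∷ []) ∷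
  layer 2029 1898 (family 1037 590 302 928 474 1236 632 596 304 ∷ []) ∷
  layer 2081 1150 (family 102 320 16 656 32 1140 56 256 12 ∷
                   family 1979 279 266 1405 1336 1397 1329 986 937 ∷ []) ∷
  layer 2089 1216 (family 789 763 289 1714 647 861 326 1685 636 ∷ []) ∷
  layer 2113 550 (family 2048 167 162 290 281 781 757 53 51 ∷ []) ∷
  layer 2129 2059 (family 1757 837 691 530 437 957 790 461 380 ∷ []) ∷
  layer 2137 1850 (family 1841 548 473 1933 1665 750 647 1889 1627 ∷ []) ∷
  layer 2141 150 (family 997 815 380 1066 497 1255 585 841 392 ∷
                  family 1119 153 80 2018 1055 813 425 1913 1000 ∷
                  family 1523 353 252 178 127 613 437 73 52 ∷
                  family 1806 795 671 1250 1055 1275 1076 1025 865 ∷ []) ∷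
  layer 2153 282 (family 232 39 5 1717 185 1349 146 1370 147 ∷ []) ∷
  layer 2161 1456 (family 553 155 40 986 253 1385 355 461 118 ∷
                   family 1356 65 41 1250 785 1475 926 725 455 ∷
                   family 2014 17 16 338 315 853 795 53 49 ∷ []) ∷
  layer 2213 463 (family 80 556 21 212 8 666 25 160 6 ∷ family 83 478 18 2045 77 744 28 1993 75 ∷
                  family 816 978 361 1360 502 1184 437 1268 468 ∷
                  family 1083 739 362 769 376 1199 587 514 251 ∷
                  family 1130 67 35 1745 891 1401 716 1378 703 ∷
                  family 1874 996 844 937 794 1166 988 845 716 ∷ []) ∷
  layer 2221 1910 (family 790 423 151 1201 427 1461 520 730 259 ∷ []) ∷
  layer 2237 412 (family 1216 61 34 1882 1023 1303 709 1585 861 ∷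
                  family 1901 291 248 410 349 951 809 113 96 ∷ []) ∷
  layer 2269 1008 (family 1287 276 157 1021 579 1440 817 493 279 ∷ []) ∷
  layer 2273 1763 (family 290 459 59 997 127 1409 180 530 67 ∷
                   family 463 622 127 1460 298 1446 295 1108 226 ∷
                   family 2219 694 678 1037 1013 1374 1342 685 669 ∷ []) ∷
  layer 2281 1722 (family 710 769 240 1450 451 1383 431 1181 367 ∷ []) ∷
  layer 2297 331 (family 1932 159 134 610 513 1171 985 173 145 ∷ []) ∷
  layer 2309 409 (family 1621 263 185 842 591 1353 950 337 236 ∷ []) ∷
  layer 2333 2036 (family 2225 235 225 2050 1955 1205 1150 1825 1740 ∷ []) ∷
  layer 2377 172 (family 1243 361 189 530 277 1109 580 173 90 ∷ []) ∷
  layer 2393 242 (family 1422 154 92 1168 694 1568 932 580 344 ∷ []) ∷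
  layer 2417 2364 (family 451 994 186 1117 209 1358 254 925 173 ∷
                   family 552 966 221 1460 334 1386 317 1268 290 ∷
                   family 592 736 181 1765 432 1406 345 1513 370 ∷
                   family 600 4 1 2368 588 584 145 2320 576 ∷ family 995 192 80 65 27 396 164 17 7 ∷
                   family 1825 471 356 877 662 1397 1055 410 309 ∷ []) ∷
  layer 2437 2282 (family 1913 666 523 1872 1470 1392 1093 1620 1272 ∷
                   family 2039 221 185 226 189 741 620 41 34 ∷
                   family 2144 804 708 745 656 1254 1104 493 434 ∷ []) ∷
  layer 2441 2152 (family 1769 779 565 1114 807 1465 1062 757 548 ∷ []) ∷
  layer 2473 1360 (family 567 94 22 1108 254 1578 362 500 114 ∷ []) ∷
  layer 2477 1392 (family 1562 501 316 170 107 639 403 113 71 ∷ []) ∷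
  layer 2521 603 (family 71 243 7 394 11 993 28 85 2 ∷
                  family 2450 333 324 954 927 1497 1455 405 393 ∷ []) ∷
  layer 2549 2071 (family 357 7 1 50 7 357 50 1 0 ∷ family 432 783 133 1690 287 1567 266 1361 231 ∷
                   family 1245 867 424 1090 533 1483 725 761 372 ∷ []) ∷
  layer 2557 2437 (family 1946 261 199 937 713 1503 1144 370 281 ∷ []) ∷
  layer 2609 246 (family 389 132 20 832 124 1448 216 272 40 ∷ []) ∷
  layer 2617 1293 (family 667 151 39 1346 343 1741 444 701 178 ∷
                   family 1950 369 275 125 93 569 424 58 43 ∷ []) ∷
  layer 2621 1517 (family 472 23 5 2249 405 1473 266 1930 347 ∷
                   family 1351 373 193 449 232 1077 556 130 67 ∷ []) ∷
  layer 2633 1651 (family 1409 138 74 400 214 1024 548 68 36 ∷ []) ∷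
  layer 2657 1222 (family 163 513 32 1405 86 1739 107 842 51 ∷ []) ∷
  layer 2689 1259 (family 1547 879 506 821 472 1385 797 538 309 ∷ []) ∷
  layer 2693 338 (family 1834 324 221 937 638 1546 1053 365 248 ∷ []) ∷
  layer 2713 1300 (family 887 1088 356 772 252 1290 422 656 214 ∷
                   family 1666 909 559 522 321 1119 688 405 249 ∷
                   family 1826 684 461 1709 1150 1754 1181 1249 840 ∷
                   family 1946 807 579 2290 1643 1221 876 2173 1559 ∷ []) ∷
  layer 2741 1533 (family 656 755 181 841 201 1445 346 466 111 ∷
                   family 2085 951 724 1649 1254 1665 1267 1322 1005 ∷ []) ∷
  layer 2749 1484 (family 640 467 109 761 177 1417 330 290 67 ∷ []) ∷
  layer 2753 2234 (family 1046 21 8 2597 987 1071 407 2450 931 ∷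
                   family 1566 343 196 205 117 749 427 58 33 ∷ []) ∷
  layer 2797 1339 (family 603 291 63 738 159 1419 306 225 48 ∷ []) ∷
  layer 2801 1173 (family 1258 142 64 628 282 1318 592 148 66 ∷ []) ∷
  layer 2833 1688 (family 1357 389 187 1898 909 1903 912 1325 634 ∷ []) ∷
  layer 2837 2431 (family 2421 570 487 1649 1407 1878 1603 1073 915 ∷ []) ∷
  layer 2857 1238 (family 896 115 37 2669 837 1177 370 2498 783 ∷ []) ∷
  layer 2861 2167 (family 489 3 1 745 128 1447 248 194 33 ∷
                   family 1202 333 140 274 115 883 371 65 27 ∷
                   family 1659 487 283 1730 1003 1917 1112 1129 654 ∷ []) ∷
  layer 2897 2074 (family 1777 121 75 2258 1385 1851 1136 1765 1082 ∷ []) ∷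
  layer 2909 1144 (family 56 810 16 1525 30 1840 36 1025 20 ∷
                   family 878 1072 324 1300 392 1682 508 976 294 ∷
                   family 987 780 265 1684 572 1870 635 1184 402 ∷
                   family 2031 172 121 2657 1855 1338 935 2437 1701 ∷
                   family 2241 278 215 272 210 888 685 52 40 ∷ []) ∷
  layer 2917 1133 (family 54 381 8 2762 51 977 19 2665 49 ∷
                   family 2863 888 872 1280 1256 1744 1712 832 816 ∷ []) ∷
  layer 2953 114 (family 1139 404 156 2153 831 1928 744 1625 627 ∷
                  family 1727 457 268 2165 1266 1909 1117 1658 969 ∷
                  family 2883 656 641 1040 1016 1676 1637 512 500 ∷ []) ∷
  layer 2957 805 (family 1735 524 308 1616 948 1956 1148 976 572 ∷ []) ∷
  layer 2969 1377 (family 2005 282 191 1669 1127 2006 1355 965 651 ∷ []) ∷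
  layer 3037 1401 (family 281 611 57 1418 131 1921 178 785 72 ∷
                   family 2756 414 376 928 842 1644 1492 340 308 ∷ []) ∷
  layer 3041 166 (family 631 342 71 2900 602 978 203 2804 582 ∷
                  family 774 1052 268 740 188 1398 356 544 138 ∷
                  family 925 852 260 449 137 1128 344 305 93 ∷
                  family 1772 688 401 2704 1576 1292 753 2560 1492 ∷
                  family 1894 538 336 205 128 782 488 109 68 ∷ []) ∷
  layer 3049 1212 (family 475 1281 200 1325 206 1673 261 1114 173 ∷ []) ∷
  layer 3061 3047 (family 168 1158 64 1629 90 1812 100 1305 72 ∷
                   family 1075 1152 405 1684 592 1818 639 1360 478 ∷ []) ∷
  layer 3089 1838 (family 319 972 101 1040 108 1668 173 656 68 ∷
                   family 393 876 112 1700 216 1962 250 1184 150 ∷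
                   family 2508 788 640 2305 1872 1852 1504 1921 1560 ∷
                   family 2696 363 317 565 493 1313 1146 146 127 ∷ []) ∷
  layer 3109 2166 (family 727 387 91 1570 367 2043 478 841 196 ∷ []) ∷
  layer 3137 1595 (family 56 866 16 1696 30 1996 36 1156 20 ∷
                   family 767 1437 352 1090 267 1531 375 1037 254 ∷
                   family 1182 1419 535 2098 791 1549 584 2045 771 ∷
                   family 1609 959 492 2762 1417 1113 571 2725 1398 ∷
                   family 2285 1001 730 410 299 1071 781 373 272 ∷ []) ∷
  layer 3169 238 (family 1844 1233 718 1690 983 1857 1081 1381 803 ∷
                  family 2044 762 492 1261 814 1878 1212 685 442 ∷
                  family 2969 558 523 2196 2058 2082 1951 1620 1518 ∷ []) ∷
  layer 3209 2961 (family 1682 30 16 1525 800 2090 1096 725 380 ∷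
                   family 2725 30 26 1684 1430 2150 1826 884 750 ∷ []) ∷
  layer 3217 1546 (family 1436 188 84 260 116 914 408 32 14 ∷ []) ∷
  layer 3221 2787 (family 2987 262 243 109 101 592 549 25 23 ∷ []) ∷
  layer 3229 363 (family 2390 863 639 761 563 1513 1120 410 303 ∷ []) ∷
  layer 3253 428 (family 1598 991 487 593 291 1327 652 410 201 ∷ []) ∷
  layer 3257 2120 (family 291 519 47 2050 183 2189 196 1373 122 ∷ []) ∷
  layer 3301 2974 (family 1212 821 302 1850 679 2137 785 1241 455 ∷ []) ∷
  layer 3313 595 (family 2906 1089 956 2594 2275 1699 1491 2389 2095 ∷ []) ∷
  layer 3329 6 (family 1729 473 246 1117 580 1877 975 442 229 ∷ []) ∷
  layer 3373 225 (family 1105 1278 419 1097 359 1730 567 841 275 ∷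
                  family 2268 639 430 1138 765 1893 1273 505 339 ∷ []) ∷
  layer 3413 1092 (family 1471 951 410 409 176 1139 491 314 135 ∷
                   family 1877 51 29 65 36 471 260 2 1 ∷
                   family 1942 175 100 1450 825 2135 1215 625 355 ∷ []) ∷
  layer 3433 2723 (family 1651 508 245 2377 1143 2280 1097 1721 827 ∷ []) ∷
  layer 3457 411 (family 708 419 86 650 133 1489 305 173 35 ∷
                  family 2749 479 381 346 275 1089 866 101 80 ∷ []) ∷
  layer 3469 1397 (family 2466 303 216 2106 1497 2367 1683 1305 927 ∷ []) ∷
  layer 3517 1043 (family 596 993 169 2545 431 2109 358 2122 359 ∷
                   family 2848 1348 1092 1985 1608 2074 1680 1637 1326 ∷
                   family 3333 1366 1295 1808 1714 2056 1949 1460 1384 ∷ []) ∷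
  layer 3533 3510 (family 548 209 33 2057 319 2409 374 1210 187 ∷
                   family 1660 829 390 1465 689 2129 1001 802 377 ∷
                   family 2007 621 353 2393 1360 2337 1328 1730 983 ∷ []) ∷
  layer 3557 3056 (family 943 169 45 698 185 1569 416 145 38 ∷ []) ∷
  layer 3581 1332 (family 364 312 32 1024 104 1888 192 320 32 ∷
                   family 1999 188 105 3188 1780 1818 1015 2848 1590 ∷
                   family 2207 638 394 533 329 1368 844 193 119 ∷ []) ∷
  layer 3593 1607 (family 1153 1084 348 512 164 1296 416 400 128 ∷ []) ∷
  layer 3613 1818 (family 3528 1329 1298 962 939 1709 1669 745 727 ∷ []) ∷
  layer 3617 2876 (family 2383 38 26 3488 2298 1140 752 3364 2216 ∷ []) ∷
  layer 3637 3249 (family 1027 1563 442 2353 664 1935 547 2194 619 ∷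
                   family 2610 202 145 145 104 726 521 17 12 ∷ []) ∷
  layer 3677 2525 (family 2368 24 16 2000 1288 2484 1600 1088 700 ∷ []) ∷
  layer 3697 907 (family 1131 846 259 697 213 1572 481 325 99 ∷ []) ∷
  layer 3701 1870 (family 1279 862 298 400 138 1192 412 244 84 ∷
                   family 2422 517 339 2465 1613 2487 1628 1714 1121 ∷ []) ∷
  layer 3709 2766 (family 1609 381 166 2665 1156 2463 1069 1954 847 ∷
                   family 2100 1280 725 1025 580 1810 1025 725 410 ∷ []) ∷
  layer 3733 1969 (family 851 629 144 2273 518 2503 571 1490 339 ∷ []) ∷
  layer 3761 583 (family 3157 345 290 1525 1280 2305 1935 650 545 ∷ []) ∷
  layer 3769 1239 (family 1445 627 241 2314 887 2529 970 1525 584 ∷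
                   family 2324 1 1 1445 891 2267 1398 554 341 ∷ []) ∷
  layer 3793 109 (family 2990 380 300 1700 1340 2410 1900 800 630 ∷ []) ∷
  layer 3797 2827 (family 742 137 27 865 169 1801 352 202 39 ∷ []) ∷
  layer 3853 3707 (family 1305 101 35 3050 1033 2431 824 2417 818 ∷ []) ∷
  layer 3881 1218 (family 3684 258 245 373 354 1202 1141 53 50 ∷ []) ∷
  layer 3889 15 (family 454 1219 143 2701 315 2325 272 2258 263 ∷
                 family 3435 240 212 68 60 514 454 16 14 ∷ []) ∷
  layer 3917 160 (family 276 686 49 928 66 1876 133 340 24 ∷
                  family 835 676 145 3505 747 1774 379 3253 693 ∷
                  family 2143 168 92 3185 1743 2394 1310 2597 1421 ∷
                  family 2384 66 41 272 166 1032 629 20 12 ∷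
                  family 3082 201 159 3321 2613 2241 1764 2826 2223 ∷ []) ∷
  layer 3929 1670 (family 226 1457 84 754 43 1579 91 685 39 ∷
                   family 3703 171 162 3285 3096 2307 2175 2754 2595 ∷ []) ∷
  layer 3989 2797 (family 3508 243 214 1202 1057 2157 1897 377 331 ∷ []) ∷
  layer 4013 3288 (family 2783 405 281 538 373 1465 1016 113 78 ∷ []) ∷
  layer 4049 3849 (family 3165 1917 1499 2146 1677 2123 1660 2045 1598 ∷ []) ∷
  layer 4057 1433 (family 1857 148 68 1040 476 2036 932 272 124 ∷ []) ∷
  layer 4073 512 (family 3524 1193 1033 3277 2835 2105 1822 2986 2583 ∷ []) ∷
  layer 4129 2458 (family 3234 207 163 3589 2811 2241 1756 3130 2451 ∷ []) ∷
  layer 4133 317 (family 251 261 16 2938 179 2777 169 2105 128 ∷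
                  family 2113 523 268 1010 517 2019 1033 313 160 ∷
                  family 2190 669 355 1450 769 2369 1256 617 327 ∷
                  family 3400 89 74 3242 2667 2631 2165 2545 2093 ∷ []) ∷
  layer 4153 3720 (family 1643 27 11 1322 523 2305 912 421 166 ∷ []) ∷
  layer 4157 778 (family 1761 569 242 3985 1688 1171 497 3898 1651 ∷
                  family 2396 374 216 1808 1042 2616 1508 820 472 ∷ []) ∷
  layer 4177 1772 (family 457 201 22 37 4 393 43 10 1 ∷
                   family 3720 1634 1456 3232 2878 1908 1700 3140 2796 ∷ []) ∷
  layer 4201 2146 (family 1154 537 148 2050 563 2733 751 1069 293 ∷
                   family 3047 540 392 1412 1024 2374 1722 544 394 ∷ []) ∷
  layer 4217 598 (family 590 999 140 3005 421 2649 371 2378 333 ∷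
                  family 1551 1241 457 1597 588 2407 886 970 357 ∷
                  family 2306 240 132 3204 1752 2742 1500 2448 1338 ∷ []) ∷
  layer 4241 1558 (family 1787 1838 775 1940 818 2322 979 1684 710 ∷
                   family 2715 1802 1154 2525 1617 2358 1510 2269 1453 ∷
                   family 3197 1201 906 2749 2072 2675 2017 2122 1599 ∷ []) ∷
  layer 4261 1974 (family 721 837 142 1585 268 2487 421 754 127 ∷
                   family 3540 1191 990 2250 1869 2697 2241 1521 1263 ∷ []) ∷
  layer 4289 2037 (family 528 8 1 65 8 528 65 1 0 ∷
                   family 1376 162 52 4045 1298 1658 532 3821 1226 ∷
                   family 2291 618 331 340 182 1202 643 116 62 ∷
                   family 3761 1651 1448 1061 930 1935 1697 898 787 ∷ []) ∷
  layer 4297 679 (family 2325 582 315 405 219 1314 711 117 63 ∷ []) ∷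
  layer 4337 552 (family 886 411 84 162 33 837 171 45 9 ∷ []) ∷
  layer 4349 119 (family 608 471 66 666 93 1695 237 153 21 ∷ []) ∷
  layer 4357 4289 (family 66 213 4 3370 51 2799 43 2617 39 ∷ []) ∷
  layer 4373 679 (family 743 121 21 1385 236 2421 412 442 75 ∷
                  family 2469 51 29 898 507 1973 1114 185 104 ∷ []) ∷
  layer 4397 931 (family 505 556 64 628 72 1654 190 160 18 ∷
                  family 3892 1 1 505 447 1489 1318 58 51 ∷ []) ∷
  layer 4409 4053 (family 332 954 72 720 54 1752 132 324 24 ∷ []) ∷
  layer 4421 828 (family 863 312 61 3604 704 2678 523 2960 578 ∷
                  family 952 1186 256 2704 582 2840 612 1972 424 ∷
                  family 4129 858 802 1069 999 2132 1992 425 397 ∷ []) ∷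
  layer 4441 3104 (family 2146 943 456 1418 685 2423 1171 653 315 ∷ []) ∷
  layer 4481 843 (family 98 702 16 1069 24 2158 48 365 8 ∷
                  family 3155 78 55 3604 2538 2782 1959 2900 2042 ∷
                  family 4205 163 153 178 167 893 838 13 12 ∷ []) ∷
  layer 4493 2098 (family 1972 2088 917 1940 852 2334 1025 1808 794 ∷
                   family 2213 246 122 3748 1846 2642 1302 3140 1546 ∷
                   family 2280 829 421 1433 727 2463 1250 610 309 ∷
                   family 3470 2066 1596 2677 2068 2356 1820 2545 1966 ∷ []) ∷
  layer 4517 2427 (family 3043 2039 1374 1681 1132 2281 1537 1546 1041 ∷ []) ∷
  layer 4549 1199 (family 1260 592 164 116 32 722 200 80 22 ∷ []) ∷
  layer 4597 4248 (family 2129 1094 507 1553 719 2554 1183 785 363 ∷ []) ∷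
  layer 4621 1839 (family 152 750 25 1525 50 2580 85 625 20 ∷
                   family 4469 1082 1047 2729 2639 3022 2923 1865 1803 ∷ []) ∷
  layer 4637 3580 (family 2044 1896 836 1108 488 2014 888 1040 458 ∷
                   family 2593 1959 1096 2465 1378 2619 1465 2138 1195 ∷ []) ∷
  layer 4649 2945 (family 1142 1915 471 1850 455 2505 616 1525 375 ∷
                   family 4075 1825 1600 3074 2695 2595 2275 2749 2410 ∷ []) ∷
  layer 4657 1924 (family 1912 1012 416 2368 972 3000 1232 1424 584 ∷
                   family 2745 526 311 4457 2627 1432 845 4325 2549 ∷ []) ∷
  layer 4673 1289 (family 1993 333 143 4570 1949 1081 462 4493 1916 ∷
                   family 3805 129 106 82 67 619 505 5 4 ∷ []) ∷
  layer 4721 3902 (family 1697 335 121 2746 987 3215 1156 1621 582 ∷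
                   family 3024 789 506 2890 1851 3167 2029 1901 1217 ∷
                   family 3354 15 11 1850 1315 2865 2036 725 515 ∷ []) ∷
  layer 4729 1989 (family 3364 233 166 1202 855 2363 1681 317 225 ∷ []) ∷
  layer 4733 151 (family 897 339 65 3562 675 3089 586 2705 512 ∷ []) ∷
  layer 4789 101 (family 3308 764 528 1280 884 2432 1680 464 320 ∷ []) ∷
  layer 4793 3035 (family 3313 1851 1280 2677 1850 2819 1949 2210 1527 ∷ []) ∷
  layer 4801 3224 (family 3398 953 675 2381 1685 3091 2188 1370 969 ∷ []) ∷
  layer 4813 3085 (family 1868 474 184 160 62 876 340 52 20 ∷
                   family 2945 357 219 2682 1641 3255 1992 1521 930 ∷ []) ∷
  layer 4817 1378 (family 3526 141 104 3802 2783 3047 2231 3005 2199 ∷ []) ∷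
  layer 4861 2870 (family 4368 281 253 2425 2179 3207 2882 1226 1101 ∷ []) ∷
  layer 4877 4363 (family 719 1244 184 2932 432 3158 466 2080 306 ∷ []) ∷
  layer 4909 3252 (family 3296 740 497 733 492 1884 1265 221 148 ∷ []) ∷
  layer 4933 2921 (family 1194 1619 392 650 157 1681 407 617 149 ∷ []) ∷
  layer 4937 4768 (family 849 481 83 1402 241 2593 446 445 76 ∷ []) ∷
  layer 4969 4170 (family 3893 54 43 3445 2699 3378 2647 2389 1871 ∷ []) ∷
  layer 4973 934 (family 274 214 12 2965 164 3404 188 1777 98 ∷
                  family 2668 456 245 2228 1196 3162 1697 1040 558 ∷ []) ∷
  layer 4993 415 (family 158 96 4 4804 152 1614 52 4624 146 ∷ []) ∷
  layer 5009 1793 (family 4470 448 400 1040 928 2268 2024 256 228 ∷ []) ∷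
  layer 5021 1413 (family 784 1257 197 1130 177 2313 362 569 89 ∷
                   family 1363 387 106 4745 1288 1857 505 4514 1225 ∷
                   family 3247 773 500 4210 2723 2797 1809 3649 2360 ∷
                   family 3658 2113 1540 2986 2175 2809 2047 2665 1941 ∷
                   family 4294 317 272 265 227 1153 987 34 29 ∷ []) ∷
  layer 5077 1142 (family 858 899 152 362 61 1343 227 185 31 ∷
                   family 899 1676 297 3860 684 2726 483 3488 618 ∷
                   family 3027 1874 1118 1517 905 2528 1508 1145 683 ∷
                   family 4219 741 616 1153 958 2391 1987 370 307 ∷ []) ∷
  layer 5081 2564 (family 2669 807 424 461 242 1521 799 170 89 ∷ []) ∷
  layer 5101 556 (family 101 2031 41 4010 79 2183 44 3961 78 ∷
                  family 5000 1425 1397 1097 1075 2279 2234 634 621 ∷ []) ∷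
  layer 5113 809 (family 2025 72 29 2477 981 3350 1327 1201 475 ∷
                  family 3088 651 394 4234 2557 2961 1789 3589 2167 ∷ []) ∷
  layer 5153 3281 (family 4926 569 544 338 323 1317 1259 85 81 ∷ []) ∷
  layer 5189 1284 (family 245 947 45 3121 148 3463 164 2050 97 ∷
                   family 2446 660 312 4608 2172 2544 1200 4176 1968 ∷
                   family 2455 1043 494 1810 857 2947 1395 841 398 ∷
                   family 4363 1083 911 2561 2154 3327 2798 1490 1253 ∷
                   family 5096 567 557 3770 3703 3423 3362 2801 2751 ∷ []) ∷
  layer 5209 3689 (family 3111 1382 826 3232 1930 3348 2000 2372 1416 ∷ []) ∷
  layer 5233 1860 (family 2980 316 180 260 148 1166 664 32 18 ∷ []) ∷
  layer 5237 4779 (family 269 834 43 4000 206 3284 169 3188 164 ∷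
                   family 369 654 47 4813 339 2216 157 4505 317 ∷
                   family 1657 228 73 340 108 1334 423 32 10 ∷
                   family 3699 1296 916 1657 1171 2822 1994 845 597 ∷
                   family 4868 534 497 3277 3046 3568 3317 2105 1956 ∷ []) ∷
  layer 5261 352 (family 4434 108 92 5140 4332 1342 1132 5024 4234 ∷ []) ∷
  layer 5273 4450 (family 4329 264 217 1385 1137 2676 2197 377 309 ∷ []) ∷
  layer 5297 2903 (family 2313 456 200 4672 2040 2728 1192 4160 1816 ∷
                   family 2984 477 269 1525 859 2801 1578 482 271 ∷
                   family 3801 456 328 625 449 1816 1304 113 81 ∷ []) ∷
  layer 5309 2452 (family 3505 1209 799 4346 2869 2895 1912 3833 2530 ∷ []) ∷
  layer 5333 2725 (family 492 1776 164 4505 416 2166 200 4397 406 ∷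
                   family 2179 2294 938 1597 653 2524 1032 1465 599 ∷
                   family 2703 1227 622 545 276 1671 847 338 171 ∷
                   family 3796 2232 1589 3860 2748 2586 1841 3728 2654 ∷
                   family 3848 1874 1353 928 670 2068 1493 820 592 ∷ []) ∷
  layer 5381 3227 (family 1739 1212 392 1684 544 2902 938 800 258 ∷ []) ∷
  layer 5393 1531 (family 665 816 101 2053 253 3202 395 905 111 ∷
                   family 4728 1186 1040 1312 1150 2596 2276 580 508 ∷ []) ∷
  layer 5417 3346 (family 368 261 18 1458 99 2781 189 405 27 ∷ []) ∷
  layer 5437 4697 (family 4807 1083 958 2665 2356 3489 3085 1522 1345 ∷ []) ∷
  layer 5441 4843 (family 2989 247 136 1693 930 2987 1641 538 295 ∷ []) ∷
  layer 5449 5282 (family 635 2107 246 2509 292 3129 365 1970 229 ∷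
                   family 4814 262 232 2900 2562 3658 3232 1556 1374 ∷ []) ∷
  layer 5477 5215 (family 523 2633 252 2330 223 2769 265 2257 216 ∷
                   family 3531 591 382 82 53 667 431 65 42 ∷
                   family 4506 519 427 5410 4451 739 608 5393 4437 ∷
                   family 5100 2621 2441 3218 2997 2781 2590 3145 2929 ∷ []) ∷
  layer 5501 3315 (family 1115 1059 215 1930 391 3137 636 881 178 ∷
                   family 4386 1007 803 601 479 1801 1436 250 199 ∷ []) ∷
  layer 5521 2474 (family 765 144 20 260 36 1198 166 16 2 ∷
                   family 4756 1047 902 410 353 1487 1281 229 197 ∷ []) ∷
  layer 5557 2648 (family 3079 83 46 65 36 601 333 2 1 ∷ []) ∷
  layer 5569 459 (family 973 1017 178 1741 304 3027 529 730 127 ∷ []) ∷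
  layer 5573 249 (family 2017 279 101 130 47 851 308 17 6 ∷ []) ∷
  layer 5581 1977 (family 4144 172 128 1600 1188 2952 2192 464 344 ∷ []) ∷
  layer 5641 5554 (family 1429 107 28 5045 1278 2843 721 4514 1143 ∷ []) ∷
  layer 5653 630 (family 2653 1086 510 3133 1471 3732 1752 1945 913 ∷
                  family 4366 1104 853 3060 2364 3714 2869 1872 1446 ∷ []) ∷
  layer 5669 4621 (family 1046 1401 259 2825 521 3597 664 1754 323 ∷ []) ∷
  layer 5689 1221 (family 3565 265 167 5338 3345 2271 1424 5021 3146 ∷ []) ∷
  layer 5693 805 (family 1193 1845 387 2106 441 3177 666 1377 288 ∷ []) ∷
  layer 5701 276 (family 1226 1115 240 4001 861 3695 795 3026 651 ∷
                  family 2804 1475 726 2225 1095 3335 1641 1250 615 ∷ []) ∷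
  layer 5737 4316 (family 1126 257 51 3205 629 3891 764 1802 353 ∷
                   family 4611 1650 1327 4849 3897 2628 2113 4573 3675 ∷ []) ∷
  layer 5741 4582 (family 3363 657 385 794 465 2127 1246 185 108 ∷ []) ∷
  layer 5801 5383 (family 1145 2277 450 3285 648 3387 669 2754 543 ∷
                   family 1155 5 1 5725 1140 1135 226 5650 1125 ∷
                   family 4239 375 275 101 74 765 560 26 19 ∷
                   family 4656 270 217 1697 1362 3096 2485 509 408 ∷ []) ∷
  layer 5813 370 (family 1182 24 5 4148 844 3918 797 2960 602 ∷
                  family 4195 706 510 1885 1361 3236 2336 697 503 ∷ []) ∷
  layer 5821 5455 (family 1242 557 119 905 193 2287 488 194 41 ∷
                   family 4579 319 251 370 291 1467 1154 41 32 ∷ []) ∷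
  layer 5849 4104 (family 2839 1215 590 1525 740 2915 1415 650 315 ∷
                   family 3010 977 503 1277 657 2697 1388 442 227 ∷ []) ∷
  layer 5861 3653 (family 754 1173 151 569 73 1803 232 290 37 ∷
                   family 5107 1219 1063 4810 4191 3247 2830 4201 3660 ∷ []) ∷
  layer 5869 1414 (family 1042 1439 256 3026 537 3755 667 1913 339 ∷
                   family 4827 1767 1454 4217 3468 3473 2857 3562 2929 ∷ []) ∷
  layer 5881 5832 (family 4783 733 597 5018 4081 3223 2622 4373 3556 ∷ []) ∷
  layer 5897 3177 (family 279 1349 64 4618 219 3439 163 3925 186 ∷
                   family 465 1767 140 1730 137 3021 239 1037 82 ∷
                   family 543 1291 119 730 67 2041 188 373 34 ∷
                   family 5354 794 721 661 600 1966 1785 181 164 ∷ []) ∷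
  layer 5953 3324 (family 2403 2449 989 2570 1037 3289 1328 2117 854 ∷ []) ∷
  layer 5981 1165 (family 1317 213 47 586 129 1871 412 65 14 ∷ []) ∷
  layer 6029 1913 (family 1801 318 95 37 11 472 141 17 5 ∷
                   family 4563 1790 1355 4304 3258 3600 2725 3604 2728 ∷
                   family 5079 2060 1736 2225 1875 3330 2806 1525 1285 ∷ []) ∷
  layer 6089 2024 (family 455 108 9 5661 423 2598 195 5265 393 ∷
                   family 5634 361 335 5941 5497 1525 1412 5818 5383 ∷ []) ∷
  layer 6101 1871 (family 247 292 12 1088 44 2568 104 208 8 ∷
                   family 1328 485 106 2225 485 3585 781 850 185 ∷
                   family 5854 115 111 4001 3839 4185 4016 2626 2519 ∷ []) ∷
  layer 6113 2226 (family 1089 156 28 1280 228 2784 496 272 48 ∷ []) ∷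
  layer 6121 525 (family 3538 2129 1231 2549 1473 3515 2032 1802 1041 ∷ []) ∷
  layer 6173 4723 (family 2447 445 177 3706 1469 4217 1672 2257 894 ∷ []) ∷
  layer 6197 1735 (family 4190 991 671 5897 3987 1803 1220 5770 3901 ∷ []) ∷
  layer 6217 2739 (family 1124 267 49 810 147 2241 406 117 21 ∷
                   family 2465 567 225 4165 1652 4221 1674 2842 1127 ∷
                   family 3845 951 589 5218 3227 3459 2140 4525 2798 ∷
                   family 4734 1029 784 2493 1899 3759 2863 1170 891 ∷ []) ∷
  layer 6221 3757 (family 1121 1484 268 3664 660 4060 732 2512 452 ∷
                   family 5100 2421 1985 1585 1299 2837 2326 1346 1103 ∷ []) ∷
  layer 6257 4357 (family 4673 2205 1647 1314 981 2667 1992 1053 786 ∷ []) ∷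
  layer 6269 1142 (family 1523 1497 364 1985 482 3387 823 986 239 ∷
                   family 4746 2657 2012 3106 2351 3517 2663 2665 2017 ∷ []) ∷
  layer 6277 2737 (family 1205 2628 505 3060 588 3534 679 2592 498 ∷
                   family 4907 2586 2022 3613 2825 3576 2796 3145 2459 ∷
                   family 5244 274 229 577 482 1902 1589 65 54 ∷ []) ∷
  layer 6317 258 (family 4354 11 8 2642 1821 3933 2711 1105 761 ∷ []) ∷
  layer 6329 447 (family 1335 912 193 1552 328 3092 653 512 108 ∷
                  family 2067 12 4 5017 1639 3992 1304 3977 1299 ∷ []) ∷
  layer 6337 2910 (family 6159 1678 1631 845 821 2246 2183 557 541 ∷ []) ∷
  layer 6353 4510 (family 1392 165 37 5381 1179 3657 802 4562 999 ∷
                   family 4961 526 411 1597 1247 3154 2463 445 347 ∷ []) ∷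
  layer 6361 17 (family 1751 173 48 2405 662 3803 1047 914 251 ∷
                 family 4610 502 364 1184 858 2732 1980 260 188 ∷ []) ∷
  layer 6373 538 (family 1879 28 9 4745 1399 4214 1243 3533 1041 ∷
                  family 4494 640 452 4436 3128 4282 3020 3152 2222 ∷ []) ∷
  layer 6421 1963 (family 5596 1322 1153 5501 4794 3236 2821 4985 4344 ∷ []) ∷
  layer 6449 2926 (family 287 1973 88 5090 227 3387 151 4621 206 ∷
                   family 382 2267 135 1730 103 3093 184 1261 75 ∷
                   family 1589 2583 637 2725 672 3577 882 2186 539 ∷
                   family 1854 163 47 901 259 2407 692 130 37 ∷
                   family 1966 233 72 101 31 807 247 10 3 ∷
                   family 2427 2457 925 4165 1568 3703 1394 3626 1365 ∷
                   family 4595 313 224 6341 4518 1353 965 6250 4453 ∷ []) ∷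
  layer 6469 6112 (family 3492 263 142 202 109 1143 617 17 9 ∷ []) ∷
  layer 6481 1317 (family 729 2376 268 4804 540 3390 382 4432 498 ∷ []) ∷
  layer 6521 3578 (family 952 397 58 6005 877 2883 421 5554 811 ∷
                   family 4925 1123 849 725 548 2157 1630 274 207 ∷ []) ∷
  layer 6529 5540 (family 4218 1368 884 1412 912 2978 1924 592 382 ∷ []) ∷
  layer 6553 3823 (family 3186 1551 755 6029 2931 2129 1036 5914 2875 ∷
                   family 3367 856 440 1168 600 2748 1412 320 164 ∷ []) ∷
  layer 6569 2600 (family 3038 1259 583 4885 2259 4133 1912 3874 1791 ∷
                   family 3531 468 252 2880 1548 4152 2232 1296 696 ∷ []) ∷
  layer 6577 1991 (family 1624 274 68 2260 558 3774 932 788 194 ∷ []) ∷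
  layer 6581 6 (family 2727 390 162 2592 1074 3996 1656 1044 432 ∷ []) ∷
  layer 6637 6299 (family 2828 333 142 730 311 2199 937 97 41 ∷ []) ∷
  layer 6661 4580 (family 6003 817 737 4706 4241 4429 3992 3425 3086 ∷ []) ∷
  layer 6673 2408 (family 4236 1902 1208 4112 2610 4240 2692 3076 1952 ∷ []) ∷
  layer 6701 1883 (family 1721 875 225 1850 475 3465 890 625 160 ∷
                   family 4980 624 464 1744 1296 3380 2512 512 380 ∷ []) ∷
  layer 6733 1783 (family 291 2517 109 5265 228 3141 136 5058 219 ∷
                   family 1851 2649 729 1657 456 3009 828 1450 399 ∷
                   family 2217 2480 817 2701 889 3768 1241 1997 657 ∷
                   family 3164 1941 913 810 381 2241 1054 657 309 ∷
                   family 6467 1749 1680 6058 5819 2433 2337 5905 5672 ∷ []) ∷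
  layer 6737 4400 (family 4344 882 569 1945 1254 3556 2293 677 436 ∷ []) ∷
  layer 6761 5877 (family 647 347 34 674 65 2133 205 85 8 ∷
                   family 1775 73 20 5645 1482 3993 1049 4714 1237 ∷
                   family 4273 953 603 1325 838 2967 1876 394 249 ∷ []) ∷
  layer 6793 4528 (family 709 2822 295 3137 327 3800 397 2621 273 ∷ []) ∷
  layer 6829 1643 (family 5233 790 606 4304 3298 4640 3556 2804 2148 ∷
                   family 5323 20 16 2225 1735 3830 2986 725 565 ∷ []) ∷
  layer 6841 4659 (family 865 1097 139 3965 502 4583 580 2474 313 ∷
                   family 1732 1223 310 3485 883 4457 1129 1994 505 ∷
                   family 5216 508 388 4580 3492 4658 3552 3104 2366 ∷ []) ∷
  layer 6857 5469 (family 1348 836 165 4477 880 4642 913 3025 594 ∷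
                   family 5509 769 618 1205 968 2859 2297 298 239 ∷ []) ∷
  layer 6961 5724 (family 6617 2395 2277 2482 2359 3789 3602 1709 1624 ∷ []) ∷
  layer 6977 2375 (family 2063 1544 457 3217 951 4372 1293 1825 539 ∷
                   family 4914 1293 911 2245 1581 3839 2704 962 677 ∷ []) ∷
  layer 6997 1138 (family 1796 831 214 4882 1253 4677 1201 3505 899 ∷ []) ∷
  layer 7001 4493 (family 5803 117 97 146 121 1011 838 5 4 ∷ []) ∷
  layer 7013 371 (family 2480 1369 485 6185 2187 3261 1154 5722 2023 ∷
                  family 4533 379 245 178 115 1117 722 25 16 ∷ []) ∷
  layer 7057 6087 (family 84 6 1 6553 78 3036 37 6085 72 ∷ []) ∷
  layer 7109 932 (family 304 403 18 5450 233 4593 197 4201 179 ∷ []) ∷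
  layer 7129 4027 (family 267 1293 49 4090 153 4743 178 2581 96 ∷
                   family 6862 1152 1109 1037 998 2698 2597 337 324 ∷ []) ∷
  layer 7213 3640 (family 1999 704 196 6452 1788 3526 978 5840 1618 ∷
                   family 2751 538 206 725 277 2284 872 113 43 ∷
                   family 5214 1322 956 2720 1966 4244 3068 1268 916 ∷
                   family 5554 1388 1069 4820 3712 4754 3661 3488 2686 ∷
                   family 7113 1766 1742 3077 3035 4376 4316 1745 1721 ∷ []) ∷
  layer 7229 1677 (family 1200 512 85 7156 1188 1018 169 7120 1182 ∷
                   family 1994 678 188 101 28 852 236 65 18 ∷ []) ∷
  layer 7237 2240 (family 2502 101 35 593 205 2071 716 50 17 ∷ []) ∷
  layer 7253 7246 (family 2211 1399 427 3842 1171 4749 1448 2305 702 ∷ []) ∷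
  layer 7297 544 (family 3553 1509 735 1818 885 3561 1734 765 372 ∷ []) ∷
  layer 7321 6920 (family 7200 1563 1538 6098 5997 3917 3853 5413 5323 ∷ []) ∷
  layer 7333 3829 (family 2909 461 183 890 353 2551 1012 137 54 ∷ []) ∷
  layer 7349 3668 (family 770 787 83 2122 223 3887 408 697 73 ∷
                   family 5288 213 154 5402 3887 4887 3517 3977 2861 ∷ []) ∷
  layer 7369 5228 (family 3219 1422 622 981 429 2658 1162 405 177 ∷
                   family 4757 618 399 6676 4310 3462 2235 6100 3938 ∷
                   family 6762 705 647 533 489 1979 1816 106 97 ∷ []) ∷
  layer 7393 3669 (family 5032 1734 1181 5645 3842 4414 3005 4717 3210 ∷ []) ∷
  layer 7417 7033 (family 2737 1481 547 3602 1329 4747 1752 2045 754 ∷ []) ∷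
  layer 7457 5987 (family 1275 1795 307 674 115 2187 374 493 84 ∷
                   family 6182 24 20 772 640 2398 1988 80 66 ∷ []) ∷
  layer 7477 6855 (family 1652 893 198 5210 1151 4999 1105 3737 825 ∷ []) ∷
  layer 7481 3571 (family 6073 2117 1719 3298 2677 4523 3672 2053 1666 ∷ []) ∷
  layer 7489 598 (family 5898 223 176 2810 2213 4463 3515 1061 835 ∷ []) ∷
  layer 7517 4634 (family 1266 2557 431 4610 777 4581 772 3697 623 ∷
                   family 1571 507 106 6970 1457 3191 667 6497 1358 ∷
                   family 3711 2689 1328 3578 1767 4449 2197 2665 1316 ∷
                   family 5938 1299 1027 778 615 2399 1896 305 241 ∷ []) ∷
  layer 7529 5614 (family 2445 1770 575 1525 495 3310 1075 725 235 ∷ []) ∷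
  layer 7537 2658 (family 1049 224 32 6208 864 4536 632 5120 712 ∷
                   family 6488 822 708 3060 2634 4614 3972 1332 1146 ∷ []) ∷
  layer 7549 3964 (family 288 1902 73 3600 138 4728 181 2196 84 ∷
                   family 1612 858 184 981 210 2712 580 225 48 ∷
                   family 2931 72 28 340 132 1602 622 16 6 ∷
                   family 5321 1668 1176 4705 3317 4962 3498 3301 2327 ∷ []) ∷
  layer 7561 1837 (family 4638 2725 1672 3442 2111 4419 2711 2549 1563 ∷ []) ∷
  layer 7573 7261 (family 3830 787 399 7417 3751 1485 752 7346 3715 ∷ []) ∷
  layer 7589 893 (family 3270 907 391 1409 607 3249 1400 370 159 ∷
                  family 4319 816 465 4581 2607 5160 2937 2853 1623 ∷ []) ∷
  layer 7621 2169 (family 2038 1539 412 3370 901 4737 1267 1801 481 ∷ []) ∷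
  layer 7649 4565 (family 5286 727 503 4525 3127 5203 3596 2746 1897 ∷ []) ∷
  layer 7669 1700 (family 5377 416 292 2516 1764 4310 3022 848 594 ∷ []) ∷
  layer 7673 1210 (family 277 2111 77 6074 219 4191 152 5389 194 ∷
                   family 867 216 25 1552 176 3436 389 320 36 ∷
                   family 2275 626 186 3077 913 4686 1390 1285 381 ∷
                   family 2995 38 15 4820 1882 5274 2059 3028 1182 ∷
                   family 7396 1212 1169 5785 5576 4864 4689 4553 4388 ∷ []) ∷
  layer 7681 1773 (family 3383 403 178 3869 1704 5083 2239 1970 867 ∷
                   family 4298 1443 808 4234 2369 5073 2839 2605 1457 ∷ []) ∷
  layer 7717 3750 (family 2953 2248 861 5993 2293 4250 1627 5309 2031 ∷ []) ∷
  layer 7741 69 (family 3199 2256 933 5409 2235 4710 1947 4437 1833 ∷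
                 family 4542 124 73 1885 1106 3792 2225 461 270 ∷ []) ∷
  layer 7753 2120 (family 1146 3351 496 2493 369 3777 559 2250 333 ∷
                   family 2104 3249 882 5485 1489 3879 1053 5242 1423 ∷
                   family 2555 305 101 3778 1245 5085 1676 1853 610 ∷
                   family 5198 36 25 6697 4490 4296 2881 5785 3878 ∷ []) ∷
  layer 7757 6815 (family 812 591 62 1042 109 2837 297 185 19 ∷ []) ∷
  layer 7793 1382 (family 5579 31 23 6290 4503 4821 3452 5077 3634 ∷ []) ∷
  layer 7817 5898 (family 2564 978 321 1665 546 3576 1173 477 156 ∷ []) ∷
  layer 7829 311 (family 5792 308 228 1076 796 2898 2144 160 118 ∷ []) ∷
  layer 7841 2389 (family 198 158 4 80 2 792 20 4 0 ∷ []) ∷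
  layer 7877 4654 (family 320 441 18 666 27 2289 93 81 3 ∷ []) ∷
  layer 7901 1961 (family 357 218 10 5365 243 5392 244 3649 165 ∷
                   family 3346 1878 796 5408 2290 5052 2140 4148 1756 ∷
                   family 7060 972 869 2900 2592 4638 4145 1184 1058 ∷ []) ∷
  layer 7937 5049 (family 3148 2784 1105 1552 616 3268 1297 1280 508 ∷
                   family 3850 2556 1240 6625 3214 3496 1696 6353 3082 ∷
                   family 5975 2543 1915 4930 3711 4909 3696 3877 2918 ∷ []) ∷
  layer 7949 5242 (family 679 465 40 2225 190 4155 355 650 55 ∷ []) ∷
  layer 7993 7970 (family 2110 1287 340 2050 541 3981 1051 733 193 ∷ []) ∷
  layer 8069 1750 (family 5337 597 395 1066 705 2927 1936 185 122 ∷ []) ∷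
  layer 8081 5093 (family 3940 822 401 1801 878 3784 1845 485 236 ∷ []) ∷
  layer 8093 7410 (family 3060 869 329 3457 1307 5051 1910 1570 593 ∷ []) ∷
  layer 8101 7625 (family 90 1422 16 1636 18 3594 40 580 6 ∷
                   family 8011 367 363 626 619 2251 2226 65 64 ∷ []) ∷
  layer 8117 1475 (family 5456 894 601 7072 4754 4268 2869 6260 4208 ∷
                   family 6384 1959 1541 2041 1605 3949 3106 986 775 ∷
                   family 7693 1776 1684 1465 1389 3386 3210 653 619 ∷ []) ∷
  layer 8161 4547 (family 7959 3453 3368 3821 3726 4541 4429 3250 3169 ∷ []) ∷
  layer 8209 4591 (family 1939 913 216 2837 670 4703 1111 1082 255 ∷ []) ∷
  layer 8221 6794 (family 4476 1053 574 5626 3063 5511 3001 3985 2169 ∷ []) ∷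
  layer 8233 1427 (family 856 249 26 914 95 2741 285 109 11 ∷ []) ∷
  layer 8237 1331 (family 7950 356 344 3328 3212 5056 4880 1360 1312 ∷ []) ∷
  layer 8269 1404 (family 7626 1228 1133 4049 3734 5366 4949 2165 1996 ∷ []) ∷
  layer 8273 4444 (family 6111 429 317 922 681 2759 2038 125 92 ∷ []) ∷
  layer 8293 2643 (family 531 1894 122 6032 386 5176 332 4820 308 ∷ []) ∷
  layer 8297 5722 (family 1896 1974 452 725 166 2394 548 533 122 ∷
                   family 5702 1666 1145 7732 5314 2702 1857 7540 5182 ∷
                   family 6200 2565 1917 2349 1755 4167 3114 1458 1089 ∷ []) ∷
  layer 8317 1536 (family 1371 1552 256 1360 224 3324 548 512 84 ∷
                   family 6946 1174 981 4373 3652 5504 4597 2465 2058 ∷ []) ∷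
  layer 8329 6620 (family 1443 832 145 7129 1235 4596 797 6185 1071 ∷ []) ∷
  layer 8353 2695 (family 5665 261 178 8269 5608 1389 943 8194 5557 ∷ []) ∷
  layer 8369 7687 (family 666 995 80 6850 545 4955 395 5725 455 ∷
                   family 5946 555 395 1394 991 3405 2420 269 191 ∷ []) ∷
  layer 8389 6045 (family 4940 882 520 5200 3062 5712 3364 3316 1952 ∷ []) ∷
  layer 8429 1674 (family 6239 561 416 6385 4726 5483 4059 4874 3607 ∷ []) ∷
  layer 8461 4219 (family 1786 1744 369 7325 1546 4132 873 6701 1414 ∷
                   family 6675 2377 1876 6361 5018 4911 3875 5450 4299 ∷ []) ∷
  layer 8501 874 (family 4020 1048 496 3536 1672 5244 2480 1600 756 ∷
                  family 4481 1330 702 7972 4202 2954 1558 7684 4050 ∷ []) ∷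
  layer 8513 6790 (family 2056 3563 861 4250 1027 4809 1162 3613 873 ∷
                   family 7310 1634 1404 7712 6622 3516 3020 7300 6268 ∷
                   family 7482 3521 3095 4802 4221 4851 4264 4165 3661 ∷ []) ∷
  layer 8521 2320 (family 5915 2997 2081 4946 3433 5171 3590 3925 2724 ∷ []) ∷
  layer 8537 1024 (family 1595 1894 354 1168 218 3104 580 580 108 ∷
                   family 6942 2252 1832 6400 5204 5056 4112 5392 4384 ∷ []) ∷
  layer 8581 7478 (family 131 167 3 3866 59 5489 84 1745 26 ∷
                   family 8450 1359 1339 6409 6311 5475 5392 5002 4925 ∷ []) ∷
  layer 8597 5019 (family 2318 1641 443 4633 1249 5651 1524 2810 757 ∷ []) ∷
  layer 8609 4039 (family 6779 3903 3074 5629 4432 4331 3411 5450 4291 ∷ []) ∷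
  layer 8681 1711 (family 432 320 16 7225 360 5140 256 6025 300 ∷
                   family 928 1952 209 5008 536 5692 609 3328 356 ∷
                   family 3911 2049 924 7605 3426 3867 1743 7146 3219 ∷
                   family 4770 1453 799 5309 2917 5823 3200 3490 1917 ∷
                   family 4855 2052 1148 4553 2547 5592 3128 2873 1607 ∷
                   family 5928 1500 1025 1856 1268 3960 2705 656 448 ∷ []) ∷
  layer 8689 7951 (family 2720 2213 693 6122 1917 5423 1698 4877 1527 ∷
                   family 4628 933 497 509 271 2099 1118 130 69 ∷
                   family 6488 2663 1989 3362 2511 4973 3714 2117 1581 ∷ []) ∷
  layer 8693 8416 (family 4048 9 5 7033 3275 5363 2498 5690 2649 ∷ []) ∷
  layer 8713 7999 (family 3279 3084 1161 3357 1263 4854 1827 2385 897 ∷ []) ∷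
  layer 8741 8345 (family 5421 1251 776 1345 834 3407 2113 386 239 ∷ []) ∷
  layer 8753 4528 (family 2569 3368 989 4325 1269 5106 1499 3433 1007 ∷ []) ∷
  layer 8761 3760 (family 8293 1654 1566 3104 2938 5020 4752 1412 1336 ∷ []) ∷
  layer 8821 454 (family 297 3165 107 3842 129 5099 172 2809 94 ∷ []) ∷
  layer 8837 216 (family 795 1501 136 298 27 1601 145 265 24 ∷
                  family 3746 1413 599 8570 3633 1689 716 8537 3619 ∷
                  family 8743 1531 1515 2522 2495 4617 4568 985 974 ∷ []) ∷
  layer 8849 7722 (family 2994 3923 1328 6010 2033 4393 1487 5821 1969 ∷ []) ∷
  layer 8861 3854 (family 1416 2915 466 7225 1155 4135 661 6850 1095 ∷
                   family 1791 582 118 3236 654 5214 1054 1220 246 ∷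
                   family 3423 3195 1235 1961 758 3855 1490 1586 613 ∷ []) ∷
  layer 8893 4565 (family 2851 1636 525 4589 1471 5804 1861 2669 855 ∷
                   family 6042 2983 2027 2825 1919 4639 3152 1898 1289 ∷ []) ∷
  layer 8929 4881 (family 3424 3764 1444 5540 2124 4922 1888 5024 1926 ∷
                   family 5505 1977 1219 1066 657 3033 1870 565 348 ∷ []) ∷
  layer 8933 3412 (family 8171 3391 3102 2305 2108 4129 3777 1882 1721 ∷ []) ∷
  layer 8941 1426 (family 5861 2066 1355 6229 4083 5700 3737 4817 3157 ∷ []) ∷
  layer 8969 6311 (family 510 133 8 3922 223 5677 323 1717 97 ∷ []) ∷
  layer 9001 4822 (family 1237 1483 204 1733 238 3907 537 578 79 ∷
                   family 7764 247 214 8506 7337 3441 2969 8045 6939 ∷ []) ∷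
  layer 9029 1 (family 4032 1702 761 416 186 1908 853 340 152 ∷
                family 4467 1403 695 7954 3935 4429 2192 7225 3574 ∷
                family 4987 1528 844 8681 4795 2082 1150 8605 4753 ∷ []) ∷
  []

proposition3p3 : LowerDensityAtLeast PB2 5763 10000
proposition3p3 = sieve-lowerDensity sieve (from-yes (wellFormed? sieve)) 5763 4237
  (from-yes (10000 * survivorCount sieve ≤? 4237 * period sieve))
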